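{- For each integer $n\geq 2$, the Kneser graph $K(n,2)$ satisfies $$\operatorname{tww}(K(n,2))=\operatorname{lb}_1(K(n,2))=\begin{cases}2(n-3)&\text{if } n\geq 5,\\ 0&\text{otherwise.}\end{cases}$$
   Context: The Kneser graph $K(n,2)$ has vertex set the $2$-element subsets of $\{1,\dots,n\}$, two vertices being adjacent iff they are disjoint. A trigraph is a graph whose edges are colored red or black; a graph is a trigraph with all edges black. For a partition $\mathcal{P}$ of $V(G)$, the quotient trigraph $G/\mathcal{P}$ has vertex set $\mathcal{P}$; two parts $U,W$ are joined by a black edge if every pair $u\in U,w\in W$ is a black edge, are non-adjacent if no such pair is an edge, and are joined by a red edge otherwise. A contraction sequence of an $N$-vertex trigraph $G$ is a sequence $\mathcal{P}_N,\dots,\mathcal{P}_1$ of partitions with $\mathcal{P}_N$ discrete and each $\mathcal{P}_i$ obtained from $\mathcal{P}_{i+1}$ by merging two parts; its width is the maximum red degree over all $G/\mathcal{P}_i$; $\operatorname{tww}(G)$ is the minimum width. For $G$ with at least two vertices, $\operatorname{lb}_1(G)$ is the minimum, over all pairs of distinct vertices $u,v$, of the maximum red degree of $G/\mathcal{P}$ where $\mathcal{P}$ has $\{u,v\}$ as its only non-singleton part; for a one-vertex graph $\operatorname{lb}_1(G)=0$. -}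

module Defs where

open import Data.Nat using (ℕ; zero; suc; _≤_; _<_; _∸_; _*_; _⊔_)
open import Data.Bool using (Bool; true; false; _∧_; _∨_; not; if_then_else_)
open import Data.Fin using (Fin; zero; suc; inject₁; toℕ; _≟_)
open import Data.Fin.Properties using () renaming (_<?_ to _<ᶠ?_)
open import Data.List using (List; []; _∷_; length; lookup; map; foldr; filter; concatMap; allFin)
open import Data.Bool.ListAction using (any; all)
open import Data.Sum using (_⊎_)
open import Data.Product using (Σ; _×_; _,_; proj₁; proj₂)
open import Relation.Binary.PropositionalEquality using (_≡_; _≢_)
open import Relation.Nullary.Decidable using (⌊_⌋)

record Graph : Set where
  field
    N   : ℕ
    adj : Fin N → Fin N → Bool

open Graph public

-- the 2-element subsets {i,j} of {0,…,n-1}, each listed once as (i , j) with i < j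
pairs : (n : ℕ) → List (Fin n × Fin n)
pairs n = concatMap (λ j → map (λ i → (i , j)) (filter (λ i → i <ᶠ? j) (allFin n))) (allFin n)

disjointPair : {n : ℕ} → Fin n × Fin n → Fin n × Fin n → Bool
disjointPair (a , b) (c , d) =
  not (⌊ a ≟ c ⌋ ∨ ⌊ a ≟ d ⌋ ∨ ⌊ b ≟ c ⌋ ∨ ⌊ b ≟ d ⌋)

-- vertex v of K(n,2) is the 2-subset  lookup (pairs n) v
Kneser2 : ℕ → Graph
Kneser2 n = record
  { N   = length (pairs n)
  ; adj = λ u v → disjointPair (lookup (pairs n) u) (lookup (pairs n) v)
  }

-- Partitions of Fin N, given by their (decidable) "same part" relation

Partition : ℕ → Set
Partition N = Fin N → Fin N → Bool

discrete : (N : ℕ) → Partition N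
discrete N x y = ⌊ x ≟ y ⌋

-- P' is obtained from P by merging the (distinct) parts of u and v
MergeStep : {N : ℕ} → Partition N → Partition N → Set
MergeStep {N} P P' =
  Σ (Fin N) λ u → Σ (Fin N) λ v →
    (P u v ≡ false) ×
    ((x y : Fin N) → P' x y ≡ (P x y ∨ (P x u ∧ P v y) ∨ (P x v ∧ P u y)))

module _ (G : Graph) where
  private
    V = allFin (N G)

  someEdge : Partition (N G) → Fin (N G) → Fin (N G) → Bool
  someEdge P x y = any (λ u → P x u ∧ any (λ w → P y w ∧ adj G u w) V) V

  someNonEdge : Partition (N G) → Fin (N G) → Fin (N G) → Bool
  someNonEdge P x y = any (λ u → P x u ∧ any (λ w → P y w ∧ not (adj G u w)) V) V

  redEdge : Partition (N G) → Fin (N G) → Fin (N G) → Bool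
  redEdge P x y = not (P x y) ∧ someEdge P x y ∧ someNonEdge P x y

  -- y is the least element of its part (one representative per part)
  isRep : Partition (N G) → Fin (N G) → Bool
  isRep P y = all (λ z → not (⌊ z <ᶠ? y ⌋ ∧ P z y)) V

  count : (Fin (N G) → Bool) → ℕ
  count f = length (filter (λ y → Data.Bool._≟_ (f y) true) V)

  redDeg : Partition (N G) → Fin (N G) → ℕ
  redDeg P x = count (λ y → isRep P y ∧ redEdge P x y)

  maxRedDeg : Partition (N G) → ℕ
  maxRedDeg P = foldr (λ x m → redDeg P x ⊔ m) 0 V

  -- Contraction sequences: seq zero = P_N (discrete), seq t = P_{N-t},
  -- each obtained from the previous one by merging two parts; seq (N-1) = P_1.

  record ContractionSeq : Set where
    field
      seq      : Fin (N G) → Partition (N G)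
      start    : (t : Fin (N G)) → toℕ t ≡ 0 →
                 (x y : Fin (N G)) → seq t x y ≡ discrete (N G) x y
      merges   : (t : Fin (N G)) (t' : Fin (N G)) → toℕ t' ≡ suc (toℕ t) →
                 MergeStep (seq t) (seq t')

  open ContractionSeq public

  width : ContractionSeq → ℕ
  width S = foldr (λ t m → maxRedDeg (seq S t) ⊔ m) 0 (allFin (N G))

  TwwIs : ℕ → Set
  TwwIs k = (Σ ContractionSeq λ S → width S ≡ k) × ((S : ContractionSeq) → k ≤ width S)

  pairPartition : Fin (N G) → Fin (N G) → Partition (N G)
  pairPartition u v x y =
    ⌊ x ≟ y ⌋ ∨ (⌊ x ≟ u ⌋ ∧ ⌊ y ≟ v ⌋) ∨ (⌊ x ≟ v ⌋ ∧ ⌊ y ≟ u ⌋)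

  Lb1Is : ℕ → Set
  Lb1Is k =
    ((N G ≤ 1) × (k ≡ 0)) ⊎
    ((2 ≤ N G) ×
     (Σ (Fin (N G)) λ u → Σ (Fin (N G)) λ v → (u ≢ v) × (maxRedDeg (pairPartition u v) ≡ k)) ×
     ((u v : Fin (N G)) → u ≢ v → k ≤ maxRedDeg (pairPartition u v)))

module Submission where

-- The first contraction of any sequence merges two distinct pairs A and B, and
-- every other pair that is disjoint from exactly one of them becomes a red neighbour of the
-- merged part.  For each element x of exactly one of A and B, the pairs {x , z} with z ∉ A ∪ B
-- are such neighbours; this gives 2(n - 3) of them when A and B meet, and 4(n - 4) ≥ 2(n - 3)
-- when they are disjoint and n ≥ 5.
--
-- At stage (k , m) the pairs inside {0 , … , k} form one part, a pair {a , b} with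
-- b > k and either a < k, or a = k and b ≤ k + m, lies in the part of {0 , b}, and every other
-- pair is a singleton.  Increasing m, and then k, merges one part into another each time.  A
-- singleton {a , b} with a > k (or {0 , 1} when k = 1) is disjoint from all or from none of the
-- members of each part, so it has no red edges.  Any other red neighbour of a part is
-- represented by {0 , 1} (when k ≥ 2), by some {0 , j} with j > k, or by some {k , j} with
-- j > k + m; one of these represents the part itself, which leaves at most 2(n - 3).
--
-- For n ≤ 3 this bound is 0, and K(4,2) is a perfect matching, which is contracted edge by edge.

open import Defs
open import Data.Nat using (ℕ; zero; suc; _+_; _*_; _∸_; _≤_; _<_; _⊔_; z≤n; s≤s; z<s; s<s; _≡ᵇ_; _<ᵇ_; _≤ᵇ_; _≟_; _<?_; _≤?_)
open import Data.Nat.Properties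
open import Data.Nat.ListAction using (sum)
open import Data.Nat.Solver using (module +-*-Solver)
open import Data.Bool using (Bool; true; false; _∧_; _∨_; not; _xor_; if_then_else_; T)
import Data.Bool as Bool
open import Data.Bool.Properties using (xor-comm; ∧-zeroʳ; ∧-identityʳ; ∨-identityʳ; ∨-zeroʳ; ∧-distribˡ-∨)
open import Data.Bool.ListAction using (any; all; and; or)
open import Data.Fin using (Fin; zero; suc; toℕ; fromℕ<) renaming (_≟_ to _≟ᶠ_)
open import Data.Fin.Properties using (toℕ-injective; toℕ<n; toℕ-fromℕ<; any?; all?) renaming (_<?_ to _<ᶠ?_; <-irrefl to <ᶠ-irrefl)
open import Data.List using (List; []; _∷_; _++_; length; lookup; map; foldr; filter; concatMap; allFin; tabulate)
open import Data.List.Properties using (map-cong; map-tabulate; tabulate-lookup; length-tabulate)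
open import Data.List.Membership.Propositional using (_∈_)
open import Data.List.Membership.Propositional.Properties using (∈-allFin; ∈-lookup; ∈-concat⁺′; ∈-map⁺; ∈-filter⁺)
open import Data.List.Relation.Unary.Any using (here; there; index)
open import Data.List.Relation.Unary.Any.Properties using (lookup-index)
open import Data.List.Relation.Unary.All as All using (All; []; _∷_)
import Data.List.Relation.Unary.All.Properties as All
open import Data.List.Relation.Unary.AllPairs as AllPairs using (AllPairs; []; _∷_)
import Data.List.Relation.Unary.AllPairs.Properties as AllPairs
open import Data.List.Relation.Unary.Unique.Propositional using (Unique)
open import Data.List.Relation.Unary.Unique.Propositional.Properties using (allFin⁺)
open import Data.Vec using (Vec; []; _∷_) renaming (lookup to lookupᵥ)
open import Data.Product using (Σ; _×_; _,_; proj₁; proj₂; swap; uncurry)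
open import Data.Product.Properties using (≡-dec)
open import Data.Sum using (_⊎_; inj₁; inj₂; [_,_]′)
open import Data.Unit using (tt)
open import Data.Empty using (⊥; ⊥-elim)
open import Relation.Nullary using (¬_; Dec; yes; no; does)
open import Relation.Nullary.Decidable using (⌊_⌋; dec-true; dec-false; True; toWitness; _×-dec_; _⊎-dec_; _→-dec_)
open import Relation.Binary.PropositionalEquality
open import Relation.Binary using (DecidableEquality; tri<; tri≈; tri>)
open import Function using (_∘_; id)
open import Algebra.Properties.CommutativeSemigroup +-commutativeSemigroup using (interchange)
open +-*-Solver using (solve; _:*_; _:+_; _:=_; con)

true⇒T : ∀ {b} → b ≡ true → T b
true⇒T refl = tt

∧-true⁺ : ∀ {a b} → a ≡ true → b ≡ true → a ∧ b ≡ true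
∧-true⁺ refl refl = refl

∧-true⁻ : ∀ {a b} → a ∧ b ≡ true → (a ≡ true) × (b ≡ true)
∧-true⁻ {true} {true} _ = refl , refl

∨-true⁻ : ∀ {a b} → a ∨ b ≡ true → (a ≡ true) ⊎ (b ≡ true)
∨-true⁻ {true} _ = inj₁ refl
∨-true⁻ {false} e = inj₂ e

∨-true⁺ˡ : ∀ {a} b → a ≡ true → a ∨ b ≡ true
∨-true⁺ˡ b refl = refl

∨-true⁺ʳ : ∀ a {b} → b ≡ true → a ∨ b ≡ true
∨-true⁺ʳ true _ = refl
∨-true⁺ʳ false e = e

not-true⁺ : ∀ {a} → a ≡ false → not a ≡ true
not-true⁺ refl = refl

not-true⁻ : ∀ {a} → not a ≡ true → a ≡ false
not-true⁻ {false} _ = refl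

true≢false : true ≢ false
true≢false ()

⌊⌋-true : ∀ {A : Set} (a? : Dec A) → A → ⌊ a? ⌋ ≡ true
⌊⌋-true (yes _) _ = refl
⌊⌋-true (no ¬a) a = ⊥-elim (¬a a)

⌊⌋-true⁻ : ∀ {A : Set} (a? : Dec A) → ⌊ a? ⌋ ≡ true → A
⌊⌋-true⁻ (yes a) _ = a

⌊⌋-false : ∀ {A : Set} (a? : Dec A) → ¬ A → ⌊ a? ⌋ ≡ false
⌊⌋-false (yes a) ¬a = ⊥-elim (¬a a)
⌊⌋-false (no _) _ = refl

≡ᵇ-true⁻ : ∀ {m n} → (m ≡ᵇ n) ≡ true → m ≡ n
≡ᵇ-true⁻ e = ≡ᵇ⇒≡ _ _ (true⇒T e)

<ᵇ-true⁻ : ∀ {m n} → (m <ᵇ n) ≡ true → m < n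
<ᵇ-true⁻ e = <ᵇ⇒< _ _ (true⇒T e)

<ᵇ-false⁻ : ∀ {m n} → (m <ᵇ n) ≡ false → ¬ m < n
<ᵇ-false⁻ e m<n = true≢false (trans (sym (dec-true (_ <? _) m<n)) e)

≤ᵇ-true⁻ : ∀ {m n} → (m ≤ᵇ n) ≡ true → m ≤ n
≤ᵇ-true⁻ e = ≤ᵇ⇒≤ _ _ (true⇒T e)

≤ᵇ-false⁻ : ∀ {m n} → (m ≤ᵇ n) ≡ false → n < m
≤ᵇ-false⁻ e = ≰⇒> λ m≤n → true≢false (trans (sym (dec-true (_ ≤? _) m≤n)) e)

xor-true⁻ : ∀ {a b} → a xor b ≡ true → ((a ≡ true) × (b ≡ false)) ⊎ ((a ≡ false) × (b ≡ true))
xor-true⁻ {true} {false} _ = inj₁ (refl , refl)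
xor-true⁻ {false} {true} _ = inj₂ (refl , refl)

indicator : Bool → ℕ
indicator true = 1
indicator false = 0

sumBelow : ℕ → (ℕ → ℕ) → ℕ
sumBelow zero f = 0
sumBelow (suc n) f = f 0 + sumBelow n (f ∘ suc)

countBelow : ℕ → (ℕ → Bool) → ℕ
countBelow n φ = sumBelow n (indicator ∘ φ)

sumBelow-cong : ∀ n {f g} → (∀ j → j < n → f j ≡ g j) → sumBelow n f ≡ sumBelow n g
sumBelow-cong zero h = refl
sumBelow-cong (suc n) h = cong₂ _+_ (h 0 z<s) (sumBelow-cong n (λ j j<n → h (suc j) (s<s j<n)))

sumBelow-mono : ∀ n {f g} → (∀ j → j < n → f j ≤ g j) → sumBelow n f ≤ sumBelow n g
sumBelow-mono zero h = z≤n
sumBelow-mono (suc n) h = +-mono-≤ (h 0 z<s) (sumBelow-mono n (λ j j<n → h (suc j) (s<s j<n)))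

sumBelow-+ : ∀ n f g → sumBelow n (λ j → f j + g j) ≡ sumBelow n f + sumBelow n g
sumBelow-+ zero f g = refl
sumBelow-+ (suc n) f g =
  trans (cong (f 0 + g 0 +_) (sumBelow-+ n (f ∘ suc) (g ∘ suc))) (interchange (f 0) (g 0) _ _)

sumBelow-zero : ∀ n → sumBelow n (λ _ → 0) ≡ 0
sumBelow-zero zero = refl
sumBelow-zero (suc n) = sumBelow-zero n

sumBelow-single : ∀ n {e} c → e < n → sumBelow n (λ j → if j ≡ᵇ e then c else 0) ≡ c
sumBelow-single (suc n) {zero} c _ = trans (cong (c +_) (sumBelow-zero n)) (+-identityʳ c)
sumBelow-single (suc n) {suc e} c (s<s e<n) = sumBelow-single n c e<n

sumBelow-snoc : ∀ n f → sumBelow (suc n) f ≡ sumBelow n f + f n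
sumBelow-snoc zero f = +-identityʳ (f 0)
sumBelow-snoc (suc n) f = trans (cong (f 0 +_) (sumBelow-snoc n (f ∘ suc))) (sym (+-assoc (f 0) _ _))

triangle : ℕ → ℕ
triangle zero = 0
triangle (suc r) = suc r + triangle r

sumBelow-id : ∀ r → sumBelow (suc r) id ≡ triangle r
sumBelow-id zero = refl
sumBelow-id (suc r) = begin
  sumBelow (suc (suc r)) id   ≡⟨ sumBelow-snoc (suc r) id ⟩
  sumBelow (suc r) id + suc r ≡⟨ cong (_+ suc r) (sumBelow-id r) ⟩
  triangle r + suc r          ≡⟨ +-comm (triangle r) (suc r) ⟩
  triangle (suc r)            ∎
  where open ≡-Reasoning

indicator-mono : ∀ {a b} → (a ≡ true → b ≡ true) → indicator a ≤ indicator b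
indicator-mono {false} _ = z≤n
indicator-mono {true} h rewrite h refl = ≤-refl

indicator-∨ : ∀ a b → indicator (a ∨ b) ≤ indicator a + indicator b
indicator-∨ true b = s≤s z≤n
indicator-∨ false b = ≤-refl

indicator-∨-disjoint : ∀ a b → a ∧ b ≡ false → indicator (a ∨ b) ≡ indicator a + indicator b
indicator-∨-disjoint true false _ = refl
indicator-∨-disjoint false b _ = refl

indicator-∨-∧ : ∀ a b → indicator (a ∨ b) + indicator (a ∧ b) ≡ indicator a + indicator b
indicator-∨-∧ true true = refl
indicator-∨-∧ true false = refl
indicator-∨-∧ false b = +-identityʳ (indicator b)

indicator-not : ∀ a → indicator a + indicator (not a) ≡ 1
indicator-not true = refl
indicator-not false = refl

countBelow-cong : ∀ n {φ ψ} → (∀ j → j < n → φ j ≡ ψ j) → countBelow n φ ≡ countBelow n ψ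
countBelow-cong n h = sumBelow-cong n (λ j j<n → cong indicator (h j j<n))

countBelow-mono : ∀ n {φ ψ} → (∀ j → j < n → φ j ≡ true → ψ j ≡ true) → countBelow n φ ≤ countBelow n ψ
countBelow-mono n h = sumBelow-mono n (λ j j<n → indicator-mono (h j j<n))

countBelow-∨ : ∀ n φ ψ → countBelow n (λ j → φ j ∨ ψ j) ≤ countBelow n φ + countBelow n ψ
countBelow-∨ n φ ψ = ≤-trans (sumBelow-mono n (λ j _ → indicator-∨ (φ j) (ψ j))) (≤-reflexive (sumBelow-+ n _ _))

countBelow-∨-disjoint : ∀ n φ ψ → (∀ j → φ j ∧ ψ j ≡ false) →
  countBelow n (λ j → φ j ∨ ψ j) ≡ countBelow n φ + countBelow n ψ
countBelow-∨-disjoint n φ ψ h =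
  trans (sumBelow-cong n (λ j _ → indicator-∨-disjoint (φ j) (ψ j) (h j))) (sumBelow-+ n _ _)

countBelow-∨-∧ : ∀ n φ ψ →
  countBelow n (λ j → φ j ∨ ψ j) + countBelow n (λ j → φ j ∧ ψ j) ≡ countBelow n φ + countBelow n ψ
countBelow-∨-∧ n φ ψ = begin
  countBelow n (λ j → φ j ∨ ψ j) + countBelow n (λ j → φ j ∧ ψ j)  ≡⟨ sumBelow-+ n _ _ ⟨
  sumBelow n (λ j → indicator (φ j ∨ ψ j) + indicator (φ j ∧ ψ j))
    ≡⟨ sumBelow-cong n (λ j _ → indicator-∨-∧ (φ j) (ψ j)) ⟩
  sumBelow n (λ j → indicator (φ j) + indicator (ψ j))              ≡⟨ sumBelow-+ n _ _ ⟩
  countBelow n φ + countBelow n ψ                                    ∎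
  where open ≡-Reasoning

countBelow-all : ∀ n → countBelow n (λ _ → true) ≡ n
countBelow-all zero = refl
countBelow-all (suc n) = cong suc (countBelow-all n)

countBelow-not : ∀ n φ → countBelow n φ + countBelow n (not ∘ φ) ≡ n
countBelow-not n φ = begin
  countBelow n φ + countBelow n (not ∘ φ)                    ≡⟨ sumBelow-+ n _ _ ⟨
  sumBelow n (λ j → indicator (φ j) + indicator (not (φ j))) ≡⟨ sumBelow-cong n (λ j _ → indicator-not (φ j)) ⟩
  countBelow n (λ _ → true)                                  ≡⟨ countBelow-all n ⟩
  n                                                          ∎
  where open ≡-Reasoning

countBelow-positive : ∀ n {e} φ → e < n → φ e ≡ true → 1 ≤ countBelow n φ
countBelow-positive (suc n) {zero} φ _ φe rewrite φe = s≤s z≤n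
countBelow-positive (suc n) {suc e} φ (s<s e<n) φe =
  ≤-trans (countBelow-positive n (φ ∘ suc) e<n φe) (m≤n+m _ (indicator (φ 0)))

countBelow-≡ᵇ-∧ : ∀ n c b → countBelow n (λ j → (j ≡ᵇ c) ∧ b) ≤ indicator b
countBelow-≡ᵇ-∧ zero c b = z≤n
countBelow-≡ᵇ-∧ (suc n) (suc c) b = countBelow-≡ᵇ-∧ n c b
countBelow-≡ᵇ-∧ (suc n) zero b = ≤-reflexive (trans (cong (indicator b +_) (none n)) (+-identityʳ _))
  where
  none : ∀ n → countBelow n (λ j → (suc j ≡ᵇ 0) ∧ b) ≡ 0
  none zero = refl
  none (suc n) = none n

countBelow-≡ᵇ : ∀ n c → countBelow n (λ j → j ≡ᵇ c) ≤ 1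
countBelow-≡ᵇ n c =
  subst (_≤ 1) (countBelow-cong n (λ j _ → ∧-identityʳ (j ≡ᵇ c))) (countBelow-≡ᵇ-∧ n c true)

countBelow-<ᵇ : ∀ n c → countBelow n (c <ᵇ_) ≡ n ∸ suc c
countBelow-<ᵇ zero c = refl
countBelow-<ᵇ (suc n) zero = countBelow-all n
countBelow-<ᵇ (suc n) (suc c) = countBelow-<ᵇ n c

countBelow-below : ∀ n j → j ≤ n → countBelow n (_<ᵇ j) ≡ j
countBelow-below n zero _ = sumBelow-zero n
countBelow-below (suc n) (suc j) (s≤s j≤n) = cong suc (countBelow-below n j j≤n)

Pair : Set
Pair = ℕ × ℕ

pairCount : ℕ → (Pair → Bool) → ℕ
pairCount n g = sumBelow n (λ j → countBelow n (λ i → (i <ᵇ j) ∧ g (i , j)))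

pairCount-mono : ∀ n {g h} → (∀ i j → i < j → j < n → g (i , j) ≡ true → h (i , j) ≡ true) →
                 pairCount n g ≤ pairCount n h
pairCount-mono n H = sumBelow-mono n λ j j<n → countBelow-mono n λ i _ e →
  let i<ᵇj , gij = ∧-true⁻ e in ∧-true⁺ i<ᵇj (H i j (<ᵇ-true⁻ i<ᵇj) j<n gij)

pairCount-∨-disjoint : ∀ n g h → (∀ q → g q ∧ h q ≡ false) →
                       pairCount n (λ q → g q ∨ h q) ≡ pairCount n g + pairCount n h
pairCount-∨-disjoint n g h disjoint = trans (sumBelow-cong n λ j _ →
    trans (countBelow-cong n (λ i _ → ∧-distribˡ-∨ (i <ᵇ j) (g (i , j)) (h (i , j))))
          (countBelow-∨-disjoint n _ _ λ i → guarded (i <ᵇ j) (disjoint (i , j))))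
  (sumBelow-+ n _ _)
  where
  guarded : ∀ a {b c} → b ∧ c ≡ false → (a ∧ b) ∧ (a ∧ c) ≡ false
  guarded true e = e
  guarded false e = refl

pairCount-rows : ∀ n k g → (∀ i j → i < j → j < n → g (i , j) ≡ true → (i ≡ 0) ⊎ (i ≡ k)) →
                 pairCount n g ≤ countBelow n (λ j → g (0 , j)) + countBelow n (λ j → g (k , j))
pairCount-rows n k g rows = begin
  pairCount n g                                             ≤⟨ sumBelow-mono n column ⟩
  sumBelow n (λ j → indicator (g (0 , j)) + indicator (g (k , j))) ≡⟨ sumBelow-+ n _ _ ⟩
  countBelow n (λ j → g (0 , j)) + countBelow n (λ j → g (k , j)) ∎
  where
  open ≤-Reasoning
  column : ∀ j → j < n → countBelow n (λ i → (i <ᵇ j) ∧ g (i , j)) ≤ indicator (g (0 , j)) + indicator (g (k , j))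
  column j j<n = begin
    countBelow n (λ i → (i <ᵇ j) ∧ g (i , j))
      ≤⟨ countBelow-mono n inRow ⟩
    countBelow n (λ i → ((i ≡ᵇ 0) ∧ g (0 , j)) ∨ ((i ≡ᵇ k) ∧ g (k , j)))
      ≤⟨ countBelow-∨ n _ _ ⟩
    countBelow n (λ i → (i ≡ᵇ 0) ∧ g (0 , j)) + countBelow n (λ i → (i ≡ᵇ k) ∧ g (k , j))
      ≤⟨ +-mono-≤ (countBelow-≡ᵇ-∧ n 0 _) (countBelow-≡ᵇ-∧ n k _) ⟩
    indicator (g (0 , j)) + indicator (g (k , j)) ∎
    where
    inRow : ∀ i → i < n → (i <ᵇ j) ∧ g (i , j) ≡ true →
            ((i ≡ᵇ 0) ∧ g (0 , j)) ∨ ((i ≡ᵇ k) ∧ g (k , j)) ≡ true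
    inRow i _ e with ∧-true⁻ e
    ... | i<ᵇj , gij with rows i j (<ᵇ-true⁻ i<ᵇj) j<n gij
    ... | inj₁ refl = ∨-true⁺ˡ _ (∧-true⁺ refl gij)
    ... | inj₂ refl = ∨-true⁺ʳ _ (∧-true⁺ (dec-true (i ≟ i) refl) gij)

star : ℕ → (ℕ → Bool) → Pair → Bool
star e F (i , j) = ((i ≡ᵇ e) ∧ F j) ∨ ((j ≡ᵇ e) ∧ F i)

-- The pairs {e , j} with j > e lie in column j, and those with j < e all lie in column e.
pairCount-star : ∀ n {e} F → e < n → F e ≡ false → countBelow n F ≤ pairCount n (star e F)
pairCount-star n {e} F e<n Fe = begin
  countBelow n F                                          ≤⟨ countBelow-mono n split ⟩
  countBelow n (λ j → ((e <ᵇ j) ∧ F j) ∨ ((j <ᵇ e) ∧ F j)) ≤⟨ countBelow-∨ n _ _ ⟩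
  countBelow n (λ j → (e <ᵇ j) ∧ F j) + countBelow n (λ j → (j <ᵇ e) ∧ F j)
    ≡⟨ cong (countBelow n (λ j → (e <ᵇ j) ∧ F j) +_) (sumBelow-single n _ e<n) ⟨
  sumBelow n above + sumBelow n atCentre                  ≡⟨ sumBelow-+ n above atCentre ⟨
  sumBelow n (λ j → above j + atCentre j)                 ≤⟨ sumBelow-mono n column ⟩
  pairCount n (star e F)                                  ∎
  where
  open ≤-Reasoning
  above atCentre : ℕ → ℕ
  above j = indicator ((e <ᵇ j) ∧ F j)
  atCentre j = if j ≡ᵇ e then countBelow n (λ i → (i <ᵇ e) ∧ F i) else 0
  split : ∀ j → j < n → F j ≡ true → ((e <ᵇ j) ∧ F j) ∨ ((j <ᵇ e) ∧ F j) ≡ true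
  split j _ Fj with <-cmp e j
  ... | tri< e<j _ _ = ∨-true⁺ˡ _ (∧-true⁺ (dec-true (e <? j) e<j) Fj)
  ... | tri≈ _ refl _ = ⊥-elim (true≢false (trans (sym Fj) Fe))
  ... | tri> _ _ j<e = ∨-true⁺ʳ _ (∧-true⁺ (dec-true (j <? e) j<e) Fj)
  column : ∀ j → j < n → above j + atCentre j ≤ countBelow n (λ i → (i <ᵇ j) ∧ star e F (i , j))
  column j j<n with j ≡ᵇ e in j≡ᵇe
  ... | true with ≡ᵇ-true⁻ {j} {e} j≡ᵇe
  ...   | refl rewrite dec-false (j <? j) (<-irrefl refl) = countBelow-mono n λ i _ h →
            let i<ᵇj , Fi = ∧-true⁻ {i <ᵇ j} h in ∧-true⁺ i<ᵇj (∨-true⁺ʳ _ Fi)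
  column j j<n | false with (e <ᵇ j) ∧ F j in e<j∧Fj
  ...   | false = z≤n
  ...   | true = let e<ᵇj , Fj = ∧-true⁻ e<j∧Fj in
                 countBelow-positive n _ e<n (∧-true⁺ e<ᵇj (∨-true⁺ˡ _ (∧-true⁺ (dec-true (e ≟ e) refl) Fj)))

countList : {A : Set} → (A → Bool) → List A → ℕ
countList f [] = 0
countList f (x ∷ xs) = indicator (f x) + countList f xs

length-filter-true : {A : Set} (f : A → Bool) (xs : List A) →
                     length (filter (λ y → f y Bool.≟ true) xs) ≡ countList f xs
length-filter-true f [] = refl
length-filter-true f (x ∷ xs) with f x
... | true = cong suc (length-filter-true f xs)
... | false = length-filter-true f xs

module _ {A : Set} where

  countList-cong : ∀ {f g : A → Bool} xs → (∀ x → x ∈ xs → f x ≡ g x) → countList f xs ≡ countList g xs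
  countList-cong [] h = refl
  countList-cong (x ∷ xs) h = cong₂ _+_ (cong indicator (h x (here refl))) (countList-cong xs (λ y → h y ∘ there))

  countList-mono : ∀ {f g : A → Bool} xs → (∀ x → f x ≡ true → g x ≡ true) → countList f xs ≤ countList g xs
  countList-mono [] h = z≤n
  countList-mono (x ∷ xs) h = +-mono-≤ (indicator-mono (h x)) (countList-mono xs h)

  countList-++ : ∀ (f : A → Bool) xs ys → countList f (xs ++ ys) ≡ countList f xs + countList f ys
  countList-++ f [] ys = refl
  countList-++ f (x ∷ xs) ys =
    trans (cong (indicator (f x) +_) (countList-++ f xs ys)) (sym (+-assoc (indicator (f x)) _ _))

  countList-filter : ∀ {P : A → Set} (P? : ∀ x → Dec (P x)) f xs →
                     countList f (filter P? xs) ≡ countList (λ x → does (P? x) ∧ f x) xs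
  countList-filter P? f [] = refl
  countList-filter P? f (x ∷ xs) with does (P? x)
  ... | true = cong (indicator (f x) +_) (countList-filter P? f xs)
  ... | false = countList-filter P? f xs

  countList-remove : ∀ (_≟ₐ_ : DecidableEquality A) f {z} xs → Unique xs → z ∈ xs → f z ≡ true →
                     countList f xs ≡ suc (countList (λ y → f y ∧ not ⌊ y ≟ₐ z ⌋) xs)
  countList-remove _≟ₐ_ f {z} (x ∷ xs) (z∉xs ∷ unique) (here refl) fz
    rewrite fz | ⌊⌋-true (z ≟ₐ z) refl =
    cong suc (countList-cong xs λ y y∈xs →
      sym (trans (cong (λ b → f y ∧ not b) (⌊⌋-false (y ≟ₐ z) (y≢z y∈xs))) (∧-identityʳ (f y))))
    where
    y≢z : ∀ {y} → y ∈ xs → y ≢ z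
    y≢z y∈xs refl = All.lookup z∉xs y∈xs refl
  countList-remove _≟ₐ_ f (x ∷ xs) (z∉xs ∷ unique) (there z∈xs) fz
    rewrite ⌊⌋-false (x ≟ₐ _) (All.lookup z∉xs z∈xs) | ∧-identityʳ (f x) =
    trans (cong (indicator (f x) +_) (countList-remove _≟ₐ_ f xs unique z∈xs fz)) (+-suc _ _)

countList-map : ∀ {A B : Set} (f : B → Bool) (h : A → B) xs → countList f (map h xs) ≡ countList (f ∘ h) xs
countList-map f h [] = refl
countList-map f h (x ∷ xs) = cong (indicator (f (h x)) +_) (countList-map f h xs)

countList-concatMap : ∀ {A B : Set} (f : B → Bool) (F : A → List B) xs →
                      countList f (concatMap F xs) ≡ sum (map (countList f ∘ F) xs)
countList-concatMap f F [] = refl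
countList-concatMap f F (x ∷ xs) =
  trans (countList-++ f (F x) (concatMap F xs)) (cong (countList f (F x) +_) (countList-concatMap f F xs))

countList-tabulate : ∀ n {A : Set} (h : Fin n → A) (f : A → Bool) (φ : ℕ → Bool) →
                     (∀ i → f (h i) ≡ φ (toℕ i)) → countList f (tabulate h) ≡ countBelow n φ
countList-tabulate zero h f φ H = refl
countList-tabulate (suc n) h f φ H =
  cong₂ _+_ (cong indicator (H zero)) (countList-tabulate n (h ∘ suc) f (φ ∘ suc) (H ∘ suc))

sum-tabulate : ∀ n {A : Set} (h : Fin n → A) (f : A → ℕ) (φ : ℕ → ℕ) →
               (∀ i → f (h i) ≡ φ (toℕ i)) → sum (map f (tabulate h)) ≡ sumBelow n φ
sum-tabulate zero h f φ H = refl
sum-tabulate (suc n) h f φ H = cong₂ _+_ (H zero) (sum-tabulate n (h ∘ suc) f (φ ∘ suc) (H ∘ suc))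

module _ {A : Set} where

  any-true⁺ : ∀ (f : A → Bool) {x} xs → x ∈ xs → f x ≡ true → any f xs ≡ true
  any-true⁺ f (y ∷ xs) (here refl) e = ∨-true⁺ˡ _ e
  any-true⁺ f (y ∷ xs) (there x∈xs) e = ∨-true⁺ʳ (f y) (any-true⁺ f xs x∈xs e)

  any-true⁻ : ∀ (f : A → Bool) xs → any f xs ≡ true → Σ A λ x → x ∈ xs × f x ≡ true
  any-true⁻ f (y ∷ xs) e with ∨-true⁻ {f y} e
  ... | inj₁ fy = y , here refl , fy
  ... | inj₂ rest = let x , x∈xs , fx = any-true⁻ f xs rest in x , there x∈xs , fx

  all-true⁺ : ∀ (f : A → Bool) xs → (∀ x → x ∈ xs → f x ≡ true) → all f xs ≡ true
  all-true⁺ f [] h = refl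
  all-true⁺ f (y ∷ xs) h = ∧-true⁺ (h y (here refl)) (all-true⁺ f xs (λ x → h x ∘ there))

  all-true⁻ : ∀ (f : A → Bool) {x} xs → all f xs ≡ true → x ∈ xs → f x ≡ true
  all-true⁻ f (y ∷ xs) e (here refl) = proj₁ (∧-true⁻ {f y} e)
  all-true⁻ f (y ∷ xs) e (there x∈xs) = all-true⁻ f xs (proj₂ (∧-true⁻ {f y} e)) x∈xs

  max-upper : ∀ (h : A → ℕ) {x} xs → x ∈ xs → h x ≤ foldr (λ x m → h x ⊔ m) 0 xs
  max-upper h (y ∷ xs) (here refl) = m≤m⊔n (h y) _
  max-upper h (y ∷ xs) (there x∈xs) = ≤-trans (max-upper h xs x∈xs) (m≤n⊔m (h y) _)

  max-least : ∀ (h : A → ℕ) {b} xs → (∀ x → x ∈ xs → h x ≤ b) → foldr (λ x m → h x ⊔ m) 0 xs ≤ b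
  max-least h [] H = z≤n
  max-least h (y ∷ xs) H = ⊔-lub (H y (here refl)) (max-least h xs (λ x → H x ∘ there))

  max-cong : ∀ {g h : A → ℕ} xs → (∀ x → g x ≡ h x) →
             foldr (λ x m → g x ⊔ m) 0 xs ≡ foldr (λ x m → h x ⊔ m) 0 xs
  max-cong [] H = refl
  max-cong (x ∷ xs) H = cong₂ _⊔_ (H x) (max-cong xs H)

module _ (G : Graph) where
  private
    Vertex = Fin (N G)
    V : List Vertex
    V = allFin (N G)

  count-mono : ∀ {f g} → (∀ y → f y ≡ true → g y ≡ true) → count G f ≤ count G g
  count-mono {f} {g} h rewrite length-filter-true f V | length-filter-true g V = countList-mono V h

  count-cong : ∀ {f g} → (∀ y → f y ≡ g y) → count G f ≡ count G g
  count-cong {f} {g} h rewrite length-filter-true f V | length-filter-true g V = countList-cong V (λ y _ → h y)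

  count-remove : ∀ f {z} → f z ≡ true → count G f ≡ suc (count G (λ y → f y ∧ not ⌊ y ≟ᶠ z ⌋))
  count-remove f {z} fz =
    trans (length-filter-true f V)
   (trans (countList-remove _≟ᶠ_ f V (allFin⁺ (N G)) (∈-allFin z) fz)
          (cong suc (sym (length-filter-true (λ y → f y ∧ not ⌊ y ≟ᶠ z ⌋) V))))

  redDeg≤maxRedDeg : ∀ P x → redDeg G P x ≤ maxRedDeg G P
  redDeg≤maxRedDeg P x = max-upper (redDeg G P) V (∈-allFin x)

  maxRedDeg-least : ∀ P {b} → (∀ x → redDeg G P x ≤ b) → maxRedDeg G P ≤ b
  maxRedDeg-least P H = max-least (redDeg G P) V (λ x _ → H x)

  maxRedDeg≤width : ∀ S t → maxRedDeg G (seq S t) ≤ width G S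
  maxRedDeg≤width S t = max-upper (λ t → maxRedDeg G (seq S t)) V (∈-allFin t)

  width-least : ∀ S {b} → (∀ t → maxRedDeg G (seq S t) ≤ b) → width G S ≤ b
  width-least S H = max-least (λ t → maxRedDeg G (seq S t)) V (λ t _ → H t)

  maxRedDeg-cong : ∀ {P Q} → (∀ x y → P x y ≡ Q x y) → maxRedDeg G P ≡ maxRedDeg G Q
  maxRedDeg-cong {P} {Q} P≗Q = max-cong V λ x → count-cong λ y →
    cong₂ _∧_ (cong and (map-cong (λ z → cong (λ b → not (⌊ z <ᶠ? y ⌋ ∧ b)) (P≗Q z y)) V))
      (cong₂ _∧_ (cong not (P≗Q x y))
        (cong₂ _∧_ (edges x y (adj G)) (edges x y (λ u w → not (adj G u w)))))
    where
    edges : ∀ x y (R : Vertex → Vertex → Bool) →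
            any (λ u → P x u ∧ any (λ w → P y w ∧ R u w) V) V ≡
            any (λ u → Q x u ∧ any (λ w → Q y w ∧ R u w) V) V
    edges x y R = cong or (map-cong (λ u →
      cong₂ _∧_ (P≗Q x u) (cong or (map-cong (λ w → cong (_∧ R u w) (P≗Q y w)) V))) V)

  record RedEdgeWitness (P : Partition (N G)) (x y : Vertex) : Set where
    field
      u u′ w w′    : Vertex
      u∈x  : P x u ≡ true
      u′∈x : P x u′ ≡ true
      w∈y  : P y w ≡ true
      w′∈y : P y w′ ≡ true
      edge    : adj G u w ≡ true
      nonEdge : adj G u′ w′ ≡ false

  redEdge-witness : ∀ P x y → redEdge G P x y ≡ true → RedEdgeWitness P x y
  redEdge-witness P x y red = record
    { u = u ; u′ = u′ ; w = w ; w′ = w′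
    ; u∈x = u∈x ; u′∈x = u′∈x ; w∈y = w∈y ; w′∈y = w′∈y
    ; edge = edge ; nonEdge = not-true⁻ nonEdge }
    where
    both = proj₂ (∧-true⁻ {not (P x y)} red)
    found₁ = any-true⁻ _ V (proj₁ (∧-true⁻ {someEdge G P x y} both))
    u = proj₁ found₁
    u∈x = proj₁ (∧-true⁻ {P x u} (proj₂ (proj₂ found₁)))
    found₂ = any-true⁻ _ V (proj₂ (∧-true⁻ {P x u} (proj₂ (proj₂ found₁))))
    w = proj₁ found₂
    w∈y = proj₁ (∧-true⁻ {P y w} (proj₂ (proj₂ found₂)))
    edge = proj₂ (∧-true⁻ {P y w} (proj₂ (proj₂ found₂)))
    found₃ = any-true⁻ _ V (proj₂ (∧-true⁻ {someEdge G P x y} both))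
    u′ = proj₁ found₃
    u′∈x = proj₁ (∧-true⁻ {P x u′} (proj₂ (proj₂ found₃)))
    found₄ = any-true⁻ _ V (proj₂ (∧-true⁻ {P x u′} (proj₂ (proj₂ found₃))))
    w′ = proj₁ found₄
    w′∈y = proj₁ (∧-true⁻ {P y w′} (proj₂ (proj₂ found₄)))
    nonEdge = proj₂ (∧-true⁻ {P y w′} (proj₂ (proj₂ found₄)))

  isRep-minimal : ∀ {P y} z → isRep G P y ≡ true → ⌊ z <ᶠ? y ⌋ ≡ true → P z y ≡ false
  isRep-minimal {P} {y} z rep z<y with P z y in z∈y
  ... | false = refl
  ... | true = ⊥-elim (true≢false (trans (sym (all-true⁻ _ V rep (∈-allFin z))) (cong not (∧-true⁺ z<y z∈y))))

  redEdge-singletons : ∀ {P} → (∀ x y → P x y ≡ true → x ≡ y) → ∀ x y → redEdge G P x y ≢ true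
  redEdge-singletons {P} singleton x y red =
    true≢false (trans (sym edge) (subst₂ (λ a b → adj G a b ≡ false) (sym u≡u′) (sym w≡w′) nonEdge))
    where
    open RedEdgeWitness (redEdge-witness P x y red)
    u≡u′ = trans (sym (singleton x u u∈x)) (singleton x u′ u′∈x)
    w≡w′ = trans (sym (singleton y w w∈y)) (singleton y w′ w′∈y)

  redDeg-none : ∀ P x → (∀ y → redEdge G P x y ≢ true) → redDeg G P x ≡ 0
  redDeg-none P x none = n≤0⇒n≡0 (≤-trans (count-mono {g = λ _ → false} λ y e →
    ⊥-elim (none y (proj₂ (∧-true⁻ {isRep G P y} e)))) (≤-reflexive (nothing V)))
    where
    nothing : ∀ xs → length (filter (λ y → false Bool.≟ true) xs) ≡ 0
    nothing [] = refl
    nothing (_ ∷ xs) = nothing xs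

  module _ {u v : Vertex} where
    private
      P = pairPartition G u v

    pairPartition-redNeighbour : ∀ {y} → y ≢ u → y ≢ v → (adj G u y xor adj G v y) ≡ true →
                                 isRep G P y ∧ redEdge G P u y ≡ true
    pairPartition-redNeighbour {y} y≢u y≢v split =
      ∧-true⁺ representative (∧-true⁺ (not-true⁺ u∉y) (∧-true⁺ (someEdge-at split) (someNonEdge-at split)))
      where
      refl∈ : ∀ x → P x x ≡ true
      refl∈ x = ∨-true⁺ˡ _ (⌊⌋-true (x ≟ᶠ x) refl)
      v∈u : P u v ≡ true
      v∈u = ∨-true⁺ʳ ⌊ u ≟ᶠ v ⌋ (∨-true⁺ˡ _ (∧-true⁺ (⌊⌋-true (u ≟ᶠ u) refl) (⌊⌋-true (v ≟ᶠ v) refl)))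
      ∈y : ∀ z → P z y ≡ ⌊ z ≟ᶠ y ⌋
      ∈y z rewrite ⌊⌋-false (y ≟ᶠ v) y≢v | ⌊⌋-false (y ≟ᶠ u) y≢u
                 | ∧-zeroʳ ⌊ z ≟ᶠ u ⌋ | ∧-zeroʳ ⌊ z ≟ᶠ v ⌋ = ∨-identityʳ _
      u∉y : P u y ≡ false
      u∉y = trans (∈y u) (⌊⌋-false (u ≟ᶠ y) (y≢u ∘ sym))
      representative : isRep G P y ≡ true
      representative = all-true⁺ _ V λ z _ → not-true⁺ (minimal z)
        where
        minimal : ∀ z → ⌊ z <ᶠ? y ⌋ ∧ P z y ≡ false
        minimal z rewrite ∈y z with z ≟ᶠ y
        ... | yes refl = cong (_∧ true) (⌊⌋-false (z <ᶠ? z) (<ᶠ-irrefl refl))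
        ... | no _ = ∧-zeroʳ _
      edgeVia : ∀ {a} → P u a ≡ true → adj G a y ≡ true → someEdge G P u y ≡ true
      edgeVia {a} a∈u e =
        any-true⁺ _ V (∈-allFin a) (∧-true⁺ a∈u (any-true⁺ _ V (∈-allFin y) (∧-true⁺ (refl∈ y) e)))
      nonEdgeVia : ∀ {a} → P u a ≡ true → adj G a y ≡ false → someNonEdge G P u y ≡ true
      nonEdgeVia {a} a∈u e =
        any-true⁺ _ V (∈-allFin a) (∧-true⁺ a∈u (any-true⁺ _ V (∈-allFin y) (∧-true⁺ (refl∈ y) (not-true⁺ e))))
      someEdge-at : (adj G u y xor adj G v y) ≡ true → someEdge G P u y ≡ true
      someEdge-at s with xor-true⁻ {adj G u y} s
      ... | inj₁ (uy , _) = edgeVia (refl∈ u) uy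
      ... | inj₂ (_ , vy) = edgeVia v∈u vy
      someNonEdge-at : (adj G u y xor adj G v y) ≡ true → someNonEdge G P u y ≡ true
      someNonEdge-at s with xor-true⁻ {adj G u y} s
      ... | inj₁ (_ , vy) = nonEdgeVia v∈u vy
      ... | inj₂ (uy , _) = nonEdgeVia (refl∈ u) uy

    redDeg-pairPartition : count G (λ y → not ⌊ y ≟ᶠ u ⌋ ∧ not ⌊ y ≟ᶠ v ⌋ ∧ (adj G u y xor adj G v y))
                           ≤ redDeg G P u
    redDeg-pairPartition = count-mono λ y e →
      let y≠u , rest = ∧-true⁻ {not ⌊ y ≟ᶠ u ⌋} e
          y≠v , split = ∧-true⁻ {not ⌊ y ≟ᶠ v ⌋} rest
      in pairPartition-redNeighbour (distinct y≠u) (distinct y≠v) split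
      where
      distinct : ∀ {y z} → not ⌊ y ≟ᶠ z ⌋ ≡ true → y ≢ z
      distinct {y} {z} ne refl = true≢false (trans (sym (⌊⌋-true (y ≟ᶠ y) refl)) (not-true⁻ ne))

  firstMerge : (S : ContractionSeq G) {t₀ t₁ : Vertex} → toℕ t₀ ≡ 0 → toℕ t₁ ≡ 1 →
    Σ Vertex λ u → Σ Vertex λ v → (u ≢ v) × (∀ x y → seq S t₁ x y ≡ pairPartition G u v x y)
  firstMerge S {t₀} {t₁} t₀≡0 t₁≡1 with merges S t₀ t₁ (trans t₁≡1 (cong suc (sym t₀≡0)))
  ... | u , v , u∉v , merged = u , v , u≢v , λ x y → trans (merged x y) (fromDiscrete x y)
    where
    P₀ = seq S t₀
    discrete₀ = start S t₀ t₀≡0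
    u≢v : u ≢ v
    u≢v refl = true≢false (trans (sym (⌊⌋-true (u ≟ᶠ u) refl)) (trans (sym (discrete₀ u u)) u∉v))
    ≟-sym : ∀ a b → ⌊ a ≟ᶠ b ⌋ ≡ ⌊ b ≟ᶠ a ⌋
    ≟-sym a b with a ≟ᶠ b
    ... | yes refl = sym (⌊⌋-true (a ≟ᶠ a) refl)
    ... | no a≢b = sym (⌊⌋-false (b ≟ᶠ a) (a≢b ∘ sym))
    fromDiscrete : ∀ x y → (P₀ x y ∨ (P₀ x u ∧ P₀ v y) ∨ (P₀ x v ∧ P₀ u y)) ≡ pairPartition G u v x y
    fromDiscrete x y rewrite discrete₀ x y | discrete₀ x u | discrete₀ v y | discrete₀ x v | discrete₀ u y
      | ≟-sym v y | ≟-sym u y = refl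

  twinWidth-attained : ∀ {b} (S : ContractionSeq G) → width G S ≤ b → (∀ S → b ≤ width G S) → TwwIs G b
  twinWidth-attained S upper lower = (S , ≤-antisym upper (lower S)) , lower

  lb₁-attained : ∀ {b} → 2 ≤ N G → (S : ContractionSeq G) → width G S ≤ b →
                 (∀ u v → u ≢ v → b ≤ maxRedDeg G (pairPartition G u v)) → Lb1Is G b
  lb₁-attained {b} 2≤N S upper lower =
    let u , v , u≢v , first = firstMerge S {fromℕ< 0<N} {fromℕ< 2≤N} (toℕ-fromℕ< 0<N) (toℕ-fromℕ< 2≤N)
    in inj₂ (2≤N , (u , v , u≢v , ≤-antisym (begin
         maxRedDeg G (pairPartition G u v)   ≡⟨ maxRedDeg-cong first ⟨
         maxRedDeg G (seq S (fromℕ< 2≤N))    ≤⟨ maxRedDeg≤width S _ ⟩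
         width G S                           ≤⟨ upper ⟩
         b                                   ∎) (lower u v u≢v)) , lower)
    where
    open ≤-Reasoning
    0<N : 0 < N G
    0<N = <-trans z<s 2≤N

  mergeStep? : (P P′ : Partition (N G)) → Dec (MergeStep P P′)
  mergeStep? P P′ = any? λ u → any? λ v → (P u v Bool.≟ false) ×-dec
    all? λ x → all? λ y → P′ x y Bool.≟ (P x y ∨ (P x u ∧ P v y) ∨ (P x v ∧ P u y))

  IsContractionSeq : (Vertex → Partition (N G)) → Set
  IsContractionSeq seq =
    (∀ t → toℕ t ≡ 0 → ∀ x y → seq t x y ≡ discrete (N G) x y) ×
    (∀ t t′ → toℕ t′ ≡ suc (toℕ t) → MergeStep (seq t) (seq t′))

  isContractionSeq? : ∀ seq → Dec (IsContractionSeq seq)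
  isContractionSeq? seq =
    (all? λ t → toℕ t ≟ 0 →-dec (all? λ x → all? λ y → seq t x y Bool.≟ discrete (N G) x y)) ×-dec
    (all? λ t → all? λ t′ → toℕ t′ ≟ suc (toℕ t) →-dec mergeStep? (seq t) (seq t′))

  checkedSeq : ∀ seq → True (isContractionSeq? seq) → ContractionSeq G
  checkedSeq seq ok = record { seq = seq ; start = proj₁ (toWitness ok) ; merges = proj₂ (toWitness ok) }

-- Partitions given by labellings

module _ {A : Set} (_≟ₐ_ : DecidableEquality A) where

  kernel : ∀ {n} → (Fin n → A) → Partition n
  kernel f x y = ⌊ f x ≟ₐ f y ⌋

  redirect : A → A → A → A
  redirect ℓu ℓv a = if ⌊ a ≟ₐ ℓv ⌋ then ℓu else a

  redirect-other : ∀ ℓu ℓv {a} → a ≢ ℓv → redirect ℓu ℓv a ≡ a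
  redirect-other ℓu ℓv {a} a≢ℓv rewrite ⌊⌋-false (a ≟ₐ ℓv) a≢ℓv = refl

  redirect-target : ∀ {ℓu ℓv} → redirect ℓu ℓv ℓv ≡ ℓu
  redirect-target {ℓu} {ℓv} rewrite ⌊⌋-true (ℓv ≟ₐ ℓv) refl = refl

  redirect-same : ∀ {ℓu ℓv} → ℓu ≢ ℓv → ∀ a b →
    ⌊ redirect ℓu ℓv a ≟ₐ redirect ℓu ℓv b ⌋ ≡
    ⌊ a ≟ₐ b ⌋ ∨ (⌊ a ≟ₐ ℓu ⌋ ∧ ⌊ ℓv ≟ₐ b ⌋) ∨ (⌊ a ≟ₐ ℓv ⌋ ∧ ⌊ ℓu ≟ₐ b ⌋)
  redirect-same {ℓu} {ℓv} ℓu≢ℓv a b with a ≟ₐ ℓv | b ≟ₐ ℓv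
  ... | yes refl | yes refl rewrite ⌊⌋-true (ℓu ≟ₐ ℓu) refl | ⌊⌋-true (a ≟ₐ a) refl = refl
  ... | yes refl | no b≢ℓv
    rewrite ⌊⌋-false (a ≟ₐ b) (b≢ℓv ∘ sym) | ⌊⌋-false (a ≟ₐ ℓu) (ℓu≢ℓv ∘ sym) = refl
  ... | no a≢ℓv | yes refl rewrite ⌊⌋-false (a ≟ₐ b) a≢ℓv | ⌊⌋-true (b ≟ₐ b) refl
    = sym (trans (∨-identityʳ _) (∧-identityʳ _))
  ... | no a≢ℓv | no b≢ℓv
    rewrite ⌊⌋-false (ℓv ≟ₐ b) (b≢ℓv ∘ sym) | ∧-zeroʳ ⌊ a ≟ₐ ℓu ⌋ = sym (∨-identityʳ _)

  kernel-mergeStep : ∀ {n} {f g : Fin n → A} {u v ℓu ℓv} → ℓu ≢ ℓv → f u ≡ ℓu → f v ≡ ℓv →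
                     (∀ x → g x ≡ redirect ℓu ℓv (f x)) → MergeStep (kernel f) (kernel g)
  kernel-mergeStep {f = f} {g} {u} {v} {ℓu} {ℓv} ℓu≢ℓv refl refl g≗ =
    u , v , ⌊⌋-false (f u ≟ₐ f v) ℓu≢ℓv , λ x y →
      trans (cong₂ (λ a b → ⌊ a ≟ₐ b ⌋) (g≗ x) (g≗ y)) (redirect-same ℓu≢ℓv (f x) (f y))

_≟ₚ_ : DecidableEquality Pair
_≟ₚ_ = ≡-dec _≟_ _≟_

Valid : ℕ → Pair → Set
Valid n (a , b) = (a < b) × (b < n)

has : Pair → ℕ → Bool
has (a , b) z = (z ≡ᵇ a) ∨ (z ≡ᵇ b)

disjoint : Pair → Pair → Bool
disjoint (a , b) (c , d) = not ((a ≡ᵇ c) ∨ (a ≡ᵇ d) ∨ (b ≡ᵇ c) ∨ (b ≡ᵇ d))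

Colex : Pair → Pair → Set
Colex (a , b) (c , d) = (b < d) ⊎ ((b ≡ d) × (a < c))

colex-irrefl : ∀ q → ¬ Colex q q
colex-irrefl (a , b) (inj₁ b<b) = <-irrefl refl b<b
colex-irrefl (a , b) (inj₂ (_ , a<a)) = <-irrefl refl a<a

colex-trans : ∀ {q r s} → Colex q r → Colex r s → Colex q s
colex-trans (inj₁ b<d) (inj₁ d<f) = inj₁ (<-trans b<d d<f)
colex-trans (inj₁ b<d) (inj₂ (refl , _)) = inj₁ b<d
colex-trans (inj₂ (refl , _)) (inj₁ d<f) = inj₁ d<f
colex-trans (inj₂ (refl , a<c)) (inj₂ (refl , c<e)) = inj₂ (refl , <-trans a<c c<e)

≡ᵇ-sym : ∀ a b → (a ≡ᵇ b) ≡ (b ≡ᵇ a)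
≡ᵇ-sym zero zero = refl
≡ᵇ-sym zero (suc b) = refl
≡ᵇ-sym (suc a) zero = refl
≡ᵇ-sym (suc a) (suc b) = ≡ᵇ-sym a b

disjoint-sym : ∀ q r → disjoint q r ≡ disjoint r q
disjoint-sym (a , b) (c , d) rewrite ≡ᵇ-sym a c | ≡ᵇ-sym a d | ≡ᵇ-sym b c | ≡ᵇ-sym b d =
  cong not (middle (c ≡ᵇ a) (d ≡ᵇ a) (c ≡ᵇ b) (d ≡ᵇ b))
  where
  middle : ∀ w x y z → (w ∨ x ∨ y ∨ z) ≡ (w ∨ y ∨ x ∨ z)
  middle true x y z = refl
  middle false true true z = refl
  middle false true false z = refl
  middle false false y z = refl

disjoint-has : ∀ A c d → disjoint A (c , d) ≡ not (has A c ∨ has A d)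
disjoint-has (a , b) c d rewrite ≡ᵇ-sym a c | ≡ᵇ-sym a d | ≡ᵇ-sym b c | ≡ᵇ-sym b d =
  cong not (interchange∨ (c ≡ᵇ a) (d ≡ᵇ a) (c ≡ᵇ b) (d ≡ᵇ b))
  where
  interchange∨ : ∀ w x y z → (w ∨ x ∨ y ∨ z) ≡ ((w ∨ y) ∨ (x ∨ z))
  interchange∨ true x y z = refl
  interchange∨ false true y z rewrite ∨-zeroʳ y = refl
  interchange∨ false false y z = refl

toℕ-≟ : ∀ {m} (i j : Fin m) → ⌊ i ≟ᶠ j ⌋ ≡ (toℕ i ≡ᵇ toℕ j)
toℕ-≟ i j with i ≟ᶠ j
... | yes refl = sym (dec-true (toℕ i ≟ toℕ i) refl)
... | no i≢j = sym (dec-false (toℕ i ≟ toℕ j) (i≢j ∘ toℕ-injective))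

module Kneser (n : ℕ) where

  K : Graph
  K = Kneser2 n

  Vertex : Set
  Vertex = Fin (N K)

  private
    toℕ² : Fin n × Fin n → Pair
    toℕ² (a , b) = (toℕ a , toℕ b)

    row : Fin n → List (Fin n × Fin n)
    row j = map (λ i → (i , j)) (filter (_<ᶠ? j) (allFin n))

  pair : Vertex → Pair
  pair x = toℕ² (lookup (pairs n) x)

  adj≡disjoint : ∀ u w → adj K u w ≡ disjoint (pair u) (pair w)
  adj≡disjoint u w with lookup (pairs n) u | lookup (pairs n) w
  ... | (a , b) | (c , d) rewrite toℕ-≟ a c | toℕ-≟ a d | toℕ-≟ b c | toℕ-≟ b d = refl

  private
    pairs-valid : All (Valid n ∘ toℕ²) (pairs n)
    pairs-valid = All.concat⁺ (All.map⁺ (All.tabulate⁺ λ j →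
      All.map⁺ (All.map (λ i<j → i<j , toℕ<n j) (All.all-filter (_<ᶠ? j) (allFin n)))))

    row-snd : ∀ j → All (λ q → proj₂ q ≡ j) (row j)
    row-snd j = All.map⁺ (All.universal (λ _ → refl) _)

    pairs-sorted : AllPairs (λ q r → Colex (toℕ² q) (toℕ² r)) (pairs n)
    pairs-sorted = AllPairs.concat⁺ (All.map⁺ (All.tabulate⁺ λ j →
        AllPairs.map⁺ (AllPairs.filter⁺ (_<ᶠ? j) (AllPairs.tabulate⁺-< (λ i<i' → inj₂ (refl , i<i'))))))
      (AllPairs.map⁺ (AllPairs.tabulate⁺-< λ {j} {j'} j<j' →
        All.map (λ { refl → All.map (λ { refl → inj₁ j<j' }) (row-snd j') }) (row-snd j)))

    lookup-sorted : ∀ {A : Set} {R : A → A → Set} (xs : List A) → AllPairs R xs →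
                    (i j : Fin (length xs)) → toℕ i < toℕ j → R (lookup xs i) (lookup xs j)
    lookup-sorted (x ∷ xs) (x<xs AllPairs.∷ _) zero (suc j) _ = All.lookup x<xs (∈-lookup j)
    lookup-sorted (x ∷ xs) (_ AllPairs.∷ sorted) (suc i) (suc j) (s<s i<j) = lookup-sorted xs sorted i j i<j

  pair-valid : ∀ x → Valid n (pair x)
  pair-valid x = All.lookup pairs-valid (∈-lookup x)

  pair-colex : ∀ {x y} → toℕ x < toℕ y → Colex (pair x) (pair y)
  pair-colex = lookup-sorted (pairs n) pairs-sorted _ _

  pair-colex⁻ : ∀ {x y} → Colex (pair x) (pair y) → toℕ x < toℕ y
  pair-colex⁻ {x} {y} x<y with <-cmp (toℕ x) (toℕ y)
  ... | tri< lt _ _ = lt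
  ... | tri≈ _ eq _ rewrite toℕ-injective eq = ⊥-elim (colex-irrefl (pair y) x<y)
  ... | tri> _ _ gt = ⊥-elim (colex-irrefl (pair y) (colex-trans (pair-colex gt) x<y))

  pair-injective : ∀ {x y} → pair x ≡ pair y → x ≡ y
  pair-injective {x} {y} eq with <-cmp (toℕ x) (toℕ y)
  ... | tri< lt _ _ = ⊥-elim (colex-irrefl (pair y) (subst (λ q → Colex q (pair y)) eq (pair-colex lt)))
  ... | tri≈ _ eq′ _ = toℕ-injective eq′
  ... | tri> _ _ gt = ⊥-elim (colex-irrefl (pair x) (subst (λ q → Colex q (pair x)) (sym eq) (pair-colex gt)))

  pair-surjective : ∀ {q} → Valid n q → Σ Vertex λ x → pair x ≡ q
  pair-surjective {a , b} (a<b , b<n) =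
    index fa,fb∈pairs ,
    trans (cong toℕ² (sym (lookup-index fa,fb∈pairs))) (cong₂ _,_ (toℕ-fromℕ< a<n) (toℕ-fromℕ< b<n))
    where
    a<n = <-trans a<b b<n
    fa = fromℕ< a<n
    fb = fromℕ< b<n
    fa<fb : toℕ fa < toℕ fb
    fa<fb = subst₂ _<_ (sym (toℕ-fromℕ< a<n)) (sym (toℕ-fromℕ< b<n)) a<b
    fa,fb∈pairs : (fa , fb) ∈ pairs n
    fa,fb∈pairs = ∈-concat⁺′ (∈-map⁺ (λ i → (i , fb)) (∈-filter⁺ (_<ᶠ? fb) (∈-allFin fa) fa<fb))
                             (∈-map⁺ row (∈-allFin fb))

  count≡pairCount : ∀ g → count K (g ∘ pair) ≡ pairCount n g
  count≡pairCount g = begin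
    count K (g ∘ pair)                          ≡⟨ length-filter-true (g ∘ pair) (allFin (N K)) ⟩
    countList (g ∘ pair) (allFin (N K))          ≡⟨ countList-map g pair (allFin (N K)) ⟨
    countList g (map pair (allFin (N K)))        ≡⟨ cong (countList g) pairs-listed ⟩
    countList g (map toℕ² (pairs n))             ≡⟨ countList-map g toℕ² (pairs n) ⟩
    countList (g ∘ toℕ²) (pairs n)               ≡⟨ countList-concatMap (g ∘ toℕ²) row (allFin n) ⟩
    sum (map (countList (g ∘ toℕ²) ∘ row) (allFin n)) ≡⟨ sum-tabulate n (λ j → j) _ _ column ⟩
    pairCount n g                               ∎
    where
    open ≡-Reasoning
    pairs-listed : map pair (allFin (N K)) ≡ map toℕ² (pairs n)
    pairs-listed = begin
      map pair (tabulate (λ x → x))              ≡⟨ map-tabulate (λ x → x) pair ⟩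
      tabulate pair                              ≡⟨ map-tabulate (lookup (pairs n)) toℕ² ⟨
      map toℕ² (tabulate (lookup (pairs n)))     ≡⟨ cong (map toℕ²) (tabulate-lookup (pairs n)) ⟩
      map toℕ² (pairs n)                         ∎
    column : ∀ j → countList (g ∘ toℕ²) (row j) ≡ countBelow n (λ i → (i <ᵇ toℕ j) ∧ g (i , toℕ j))
    column j = trans (countList-map (g ∘ toℕ²) (λ i → (i , j)) (filter (_<ᶠ? j) (allFin n)))
               (trans (countList-filter (_<ᶠ? j) _ (allFin n))
                      (countList-tabulate n (λ i → i) _ _ (λ i → refl)))

  pair-≟ : ∀ x y → ⌊ pair x ≟ₚ pair y ⌋ ≡ ⌊ x ≟ᶠ y ⌋
  pair-≟ x y with x ≟ᶠ y
  ... | yes refl = ⌊⌋-true (pair x ≟ₚ pair x) refl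
  ... | no x≢y = ⌊⌋-false (pair x ≟ₚ pair y) (x≢y ∘ pair-injective)

  two≤order : 3 ≤ n → 2 ≤ N K
  two≤order 3≤n = distinct⇒two≤ (proj₁ v₀₁) (proj₁ v₀₂) λ eq →
    1≢2 (cong proj₂ (trans (sym (proj₂ v₀₁)) (trans (cong pair eq) (proj₂ v₀₂))))
    where
    v₀₁ = pair-surjective {0 , 1} (z<s , <-≤-trans (s<s z<s) 3≤n)
    v₀₂ = pair-surjective {0 , 2} (s≤s z≤n , 3≤n)
    1≢2 : 1 ≢ 2
    1≢2 ()
    distinct⇒two≤ : ∀ {m} (x y : Fin m) → x ≢ y → 2 ≤ m
    distinct⇒two≤ {suc zero} zero zero x≢y = ⊥-elim (x≢y refl)
    distinct⇒two≤ {suc (suc m)} _ _ _ = s≤s (s≤s z≤n)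

-- Lower bound

split : Pair → Pair → Pair → Bool
split A B q = not ⌊ q ≟ₚ A ⌋ ∧ not ⌊ q ≟ₚ B ⌋ ∧ (disjoint A q xor disjoint B q)

avoids : Pair → Pair → ℕ → Bool
avoids A B z = not (has A z ∨ has B z)

has-fst : ∀ a b → has (a , b) a ≡ true
has-fst a b = ∨-true⁺ˡ _ (dec-true (a ≟ a) refl)

has-snd : ∀ a b → has (a , b) b ≡ true
has-snd a b = ∨-true⁺ʳ (b ≡ᵇ a) (dec-true (b ≟ b) refl)

has-false : ∀ {a b z} → z ≢ a → z ≢ b → has (a , b) z ≡ false
has-false {a} {b} {z} z≢a z≢b rewrite dec-false (z ≟ a) z≢a | dec-false (z ≟ b) z≢b = refl

Centre : ℕ → Pair → Pair → ℕ → Set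
Centre n A B x = (x < n) × (((has A x ≡ true) × (has B x ≡ false)) ⊎ ((has B x ≡ true) × (has A x ≡ false)))

distinguished : ∀ {q r} z → has q z ≡ true → has r z ≡ false → q ≢ r
distinguished z qz rz refl = true≢false (trans (sym qz) rz)

split-intro : ∀ {A B q} → q ≢ A → q ≢ B → disjoint A q ≡ false → disjoint B q ≡ true → split A B q ≡ true
split-intro {A} {B} {q} q≢A q≢B A∩q B∩q
  rewrite ⌊⌋-false (q ≟ₚ A) q≢A | ⌊⌋-false (q ≟ₚ B) q≢B | A∩q | B∩q = refl

avoids⁻ : ∀ A B z → avoids A B z ≡ true → (has A z ≡ false) × (has B z ≡ false)
avoids⁻ A B z e with has A z | has B z
... | false | false = refl , refl

star-split : ∀ A B {x F} q → (∀ z → F z ≡ true → (has A z ≡ false) × (has B z ≡ false)) →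
             has A x ≡ true → has B x ≡ false → star x F q ≡ true → split A B q ≡ true
star-split A B {x} {F} (i , j) outside Ax Bx s with ∨-true⁻ {(i ≡ᵇ x) ∧ F j} s
... | inj₁ e with ∧-true⁻ {i ≡ᵇ x} e
...   | i≡x , Fj rewrite ≡ᵇ-true⁻ {i} i≡x =
  let Aj , Bj = outside j Fj in
  split-intro {A} {B} (distinguished j (has-snd x j) Aj) (distinguished x (has-fst x j) Bx)
    (trans (disjoint-has A x j) (cong (λ b → not (b ∨ has A j)) Ax))
    (trans (disjoint-has B x j) (cong₂ (λ b c → not (b ∨ c)) Bx Bj))
star-split A B {x} (i , j) outside Ax Bx s | inj₂ e with ∧-true⁻ {j ≡ᵇ x} e
...   | j≡x , Fi rewrite ≡ᵇ-true⁻ {j} j≡x =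
  let Ai , Bi = outside i Fi in
  split-intro {A} {B} (distinguished i (has-fst i x) Ai) (distinguished x (has-snd i x) Bx)
    (trans (disjoint-has A i x) (trans (cong (λ b → not (has A i ∨ b)) Ax) (cong not (∨-zeroʳ (has A i)))))
    (trans (disjoint-has B i x) (cong₂ (λ b c → not (b ∨ c)) Bi Bx))

split-sym : ∀ A B q → split A B q ≡ split B A q
split-sym A B q = commute (not ⌊ q ≟ₚ A ⌋) (not ⌊ q ≟ₚ B ⌋) (disjoint A q) (disjoint B q)
  where
  commute : ∀ a b c d → a ∧ b ∧ (c xor d) ≡ b ∧ a ∧ (d xor c)
  commute true true c d = xor-comm c d
  commute true false c d = refl
  commute false true c d = refl
  commute false false c d = refl

star⁻ : ∀ {x F i j} → star x F (i , j) ≡ true → ((i ≡ x) × (F j ≡ true)) ⊎ ((j ≡ x) × (F i ≡ true))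
star⁻ {x} {F} {i} {j} s with ∨-true⁻ {(i ≡ᵇ x) ∧ F j} s
... | inj₁ e = let i≡x , Fj = ∧-true⁻ {i ≡ᵇ x} e in inj₁ (≡ᵇ-true⁻ {i} i≡x , Fj)
... | inj₂ e = let j≡x , Fi = ∧-true⁻ {j ≡ᵇ x} e in inj₂ (≡ᵇ-true⁻ {j} j≡x , Fi)

star-disjoint : ∀ {x y} F q → x ≢ y → F x ≡ false → F y ≡ false → star x F q ∧ star y F q ≡ false
star-disjoint {x} {y} F (i , j) x≢y Fx Fy with star x F (i , j) in sx | star y F (i , j) in sy
... | false | _ = refl
... | true | false = refl
... | true | true = ⊥-elim (clash (star⁻ {x} {F} sx) (star⁻ {y} {F} sy))
  where
  clash : ((i ≡ x) × (F j ≡ true)) ⊎ ((j ≡ x) × (F i ≡ true)) →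
          ((i ≡ y) × (F j ≡ true)) ⊎ ((j ≡ y) × (F i ≡ true)) → ⊥
  clash (inj₁ (refl , _)) (inj₁ (i≡y , _)) = x≢y i≡y
  clash (inj₁ (refl , _)) (inj₂ (_ , Fi)) = true≢false (trans (sym Fi) Fx)
  clash (inj₂ (refl , Fi)) (inj₁ (refl , Fj)) = true≢false (trans (sym Fj) Fx)
  clash (inj₂ (refl , _)) (inj₂ (j≡y , _)) = x≢y j≡y

module _ (n : ℕ) (A B : Pair) where
  private
    F = avoids A B

  stars : List ℕ → Pair → Bool
  stars cs q = any (λ x → star x F q) cs

  centre-avoided : ∀ {x} → Centre n A B x → F x ≡ false
  centre-avoided (_ , inj₁ (Ax , _)) rewrite Ax = refl
  centre-avoided {x} (_ , inj₂ (Bx , _)) rewrite Bx = cong not (∨-zeroʳ (has A x))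

  stars-disjoint : ∀ {x} cs → All (x ≢_) cs → Centre n A B x → All (Centre n A B) cs →
                   ∀ q → star x F q ∧ stars cs q ≡ false
  stars-disjoint [] _ _ _ q = ∧-zeroʳ _
  stars-disjoint {x} (y ∷ cs) (x≢y ∷ x∉cs) cx (cy ∷ ccs) q with star x F q in sx
  ... | false = refl
  ... | true = cong₂ _∨_
    (trans (cong (_∧ star y F q) (sym sx)) (star-disjoint F q x≢y (centre-avoided cx) (centre-avoided cy)))
    (trans (cong (_∧ stars cs q) (sym sx)) (stars-disjoint cs x∉cs cx ccs q))

  stars-count : ∀ cs → Unique cs → All (Centre n A B) cs → length cs * countBelow n F ≤ pairCount n (stars cs)
  stars-count [] _ _ = z≤n
  stars-count (x ∷ cs) (x∉cs ∷ unique) (cx ∷ ccs) = begin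
    countBelow n F + length cs * countBelow n F
      ≤⟨ +-mono-≤ (pairCount-star n F (proj₁ cx) (centre-avoided cx)) (stars-count cs unique ccs) ⟩
    pairCount n (star x F) + pairCount n (stars cs)
      ≡⟨ pairCount-∨-disjoint n _ _ (stars-disjoint cs x∉cs cx ccs) ⟨
    pairCount n (stars (x ∷ cs)) ∎
    where open ≤-Reasoning

  stars-split : ∀ cs → All (Centre n A B) cs → ∀ q → stars cs q ≡ true → split A B q ≡ true
  stars-split cs ccs q s with any-true⁻ _ cs s
  ... | x , x∈cs , sx with All.lookup ccs x∈cs
  ...   | _ , inj₁ (Ax , Bx) = star-split A B q (avoids⁻ A B) Ax Bx sx
  ...   | _ , inj₂ (Bx , Ax) = trans (split-sym A B q) (star-split B A q (λ z → swap ∘ avoids⁻ A B z) Bx Ax sx)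

  centres-bound : ∀ cs → Unique cs → All (Centre n A B) cs →
                  length cs * countBelow n (avoids A B) ≤ pairCount n (split A B)
  centres-bound cs unique ccs = ≤-trans (stars-count cs unique ccs)
    (pairCount-mono n λ i j _ _ → stars-split cs ccs (i , j))

has-count : ∀ n A → countBelow n (has A) ≤ 2
has-count n (a , b) = ≤-trans (countBelow-∨ n _ _) (+-mono-≤ (countBelow-≡ᵇ n a) (countBelow-≡ᵇ n b))

avoids-count : ∀ n A B → countBelow n (avoids A B) ≡ n ∸ countBelow n (λ z → has A z ∨ has B z)
avoids-count n A B = begin
  countBelow n (avoids A B)                 ≡⟨ m+n∸m≡n (countBelow n met) _ ⟨
  countBelow n met + countBelow n (avoids A B) ∸ countBelow n met ≡⟨ cong (_∸ countBelow n met) (countBelow-not n met) ⟩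
  n ∸ countBelow n met                      ∎
  where
  open ≡-Reasoning
  met = λ z → has A z ∨ has B z

union-count-shared : ∀ n A B {s} → s < n → has A s ≡ true → has B s ≡ true →
                     countBelow n (λ z → has A z ∨ has B z) ≤ 3
union-count-shared n A B s<n As Bs = ≤-pred (begin
  suc (countBelow n (λ z → has A z ∨ has B z))
    ≡⟨ +-comm 1 _ ⟩
  countBelow n (λ z → has A z ∨ has B z) + 1
    ≤⟨ +-monoʳ-≤ _ (countBelow-positive n _ s<n (∧-true⁺ As Bs)) ⟩
  countBelow n (λ z → has A z ∨ has B z) + countBelow n (λ z → has A z ∧ has B z)
    ≡⟨ countBelow-∨-∧ n (has A) (has B) ⟩
  countBelow n (has A) + countBelow n (has B)
    ≤⟨ +-mono-≤ (has-count n A) (has-count n B) ⟩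
  4 ∎)
  where open ≤-Reasoning

shared-bound : ∀ {n A B s x y} → s < n → has A s ≡ true → has B s ≡ true →
               x < n → has A x ≡ true → has B x ≡ false → y < n → has B y ≡ true → has A y ≡ false →
               2 * (n ∸ 3) ≤ pairCount n (split A B)
shared-bound {n} {A} {B} s<n As Bs x<n Ax Bx y<n By Ay = begin
  2 * (n ∸ 3)                         ≤⟨ *-monoʳ-≤ 2 (subst (n ∸ 3 ≤_) (sym (avoids-count n A B))
                                             (∸-monoʳ-≤ n (union-count-shared n A B s<n As Bs))) ⟩
  2 * countBelow n (avoids A B)       ≤⟨ centres-bound n A B (_ ∷ _ ∷ []) ((x≢y ∷ []) ∷ [] ∷ [])
                                             ((x<n , inj₁ (Ax , Bx)) ∷ (y<n , inj₂ (By , Ay)) ∷ []) ⟩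
  pairCount n (split A B)             ∎
  where
  open ≤-Reasoning
  x≢y : _ ≢ _
  x≢y refl = true≢false (trans (sym By) Bx)

2[n∸3]≤4[n∸4] : ∀ {n} → 5 ≤ n → 2 * (n ∸ 3) ≤ 4 * (n ∸ 4)
2[n∸3]≤4[n∸4] {suc (suc (suc (suc (suc r))))} (s≤s (s≤s (s≤s (s≤s (s≤s _))))) = begin
  2 * (2 + r)       ≤⟨ *-monoʳ-≤ 2 (+-monoʳ-≤ 2 (m≤m+n r r)) ⟩
  2 * (2 + (r + r)) ≡⟨ solve 1 (λ r → con 2 :* (con 2 :+ (r :+ r)) := con 4 :* (con 1 :+ r)) refl r ⟩
  4 * (1 + r)       ∎
  where open ≤-Reasoning

disjoint-bound : ∀ {n a b c d} → 5 ≤ n → a < n → b < n → c < n → d < n →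
                 a ≢ b → a ≢ c → a ≢ d → b ≢ c → b ≢ d → c ≢ d →
                 2 * (n ∸ 3) ≤ pairCount n (split (a , b) (c , d))
disjoint-bound {n} {a} {b} {c} {d} 5≤n a<n b<n c<n d<n a≢b a≢c a≢d b≢c b≢d c≢d = begin
  2 * (n ∸ 3)                            ≤⟨ 2[n∸3]≤4[n∸4] 5≤n ⟩
  4 * (n ∸ 4)                            ≤⟨ *-monoʳ-≤ 4 (subst (n ∸ 4 ≤_) (sym (avoids-count n A B)) (∸-monoʳ-≤ n union≤4)) ⟩
  4 * countBelow n (avoids A B)          ≤⟨ centres-bound n A B (a ∷ b ∷ c ∷ d ∷ []) distinct centres ⟩
  pairCount n (split A B)                ∎
  where
  open ≤-Reasoning
  A = (a , b)
  B = (c , d)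
  union≤4 : countBelow n (λ z → has A z ∨ has B z) ≤ 4
  union≤4 = ≤-trans (countBelow-∨ n _ _) (+-mono-≤ (has-count n A) (has-count n B))
  distinct : Unique (a ∷ b ∷ c ∷ d ∷ [])
  distinct = (a≢b ∷ a≢c ∷ a≢d ∷ []) ∷ (b≢c ∷ b≢d ∷ []) ∷ (c≢d ∷ []) ∷ [] ∷ []
  centres : All (Centre n A B) (a ∷ b ∷ c ∷ d ∷ [])
  centres = (a<n , inj₁ (has-fst a b , has-false a≢c a≢d))
          ∷ (b<n , inj₁ (has-snd a b , has-false b≢c b≢d))
          ∷ (c<n , inj₂ (has-fst c d , has-false (a≢c ∘ sym) (b≢c ∘ sym)))
          ∷ (d<n , inj₂ (has-snd c d , has-false (a≢d ∘ sym) (b≢d ∘ sym))) ∷ []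

split-count : ∀ {n A B} → 5 ≤ n → Valid n A → Valid n B → A ≢ B → 2 * (n ∸ 3) ≤ pairCount n (split A B)
split-count {n} {a , b} {c , d} 5≤n (a<b , b<n) (c<d , d<n) A≢B with a ≟ c
... | yes refl = shared-bound (<-trans a<b b<n) (has-fst a b) (has-fst a d)
                   b<n (has-snd a b) (has-false (>⇒≢ a<b) b≢d) d<n (has-snd a d) (has-false (>⇒≢ c<d) (b≢d ∘ sym))
  where
  b≢d : b ≢ d
  b≢d refl = A≢B refl
... | no a≢c with a ≟ d
...   | yes refl = shared-bound (<-trans a<b b<n) (has-fst a b) (has-snd c a)
                     b<n (has-snd a b) (has-false (>⇒≢ c<b) (>⇒≢ a<b)) (<-trans c<d d<n) (has-fst c a)
                     (has-false (a≢c ∘ sym) (<⇒≢ c<b))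
  where
  c<b : c < b
  c<b = <-trans c<d a<b
...   | no a≢d with b ≟ c
...     | yes refl = shared-bound b<n (has-snd a b) (has-fst b d)
                       (<-trans a<b b<n) (has-fst a b) (has-false (<⇒≢ a<b) a≢d) d<n (has-snd b d)
                       (has-false (a≢d ∘ sym) (>⇒≢ c<d))
...     | no b≢c with b ≟ d
...       | yes refl = shared-bound b<n (has-snd a b) (has-snd c b)
                         (<-trans a<b b<n) (has-fst a b) (has-false a≢c (<⇒≢ a<b)) (<-trans c<d b<n) (has-fst c b)
                         (has-false (a≢c ∘ sym) (<⇒≢ c<d))
...       | no b≢d = disjoint-bound 5≤n (<-trans a<b b<n) b<n (<-trans c<d d<n) d<n
                       (<⇒≢ a<b) a≢c a≢d b≢c b≢d (<⇒≢ c<d)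

module _ {n : ℕ} (5≤n : 5 ≤ n) where
  open Kneser n

  redDeg-merged-lower : ∀ {u v} → u ≢ v → 2 * (n ∸ 3) ≤ redDeg K (pairPartition K u v) u
  redDeg-merged-lower {u} {v} u≢v = begin
    2 * (n ∸ 3)                               ≤⟨ split-count 5≤n (pair-valid u) (pair-valid v) (u≢v ∘ pair-injective) ⟩
    pairCount n (split (pair u) (pair v))     ≡⟨ count≡pairCount _ ⟨
    count K (split (pair u) (pair v) ∘ pair)  ≡⟨ count-cong K splitVertex ⟩
    count K splitsAt                          ≤⟨ redDeg-pairPartition K ⟩
    redDeg K (pairPartition K u v) u          ∎
    where
    open ≤-Reasoning
    splitsAt : Vertex → Bool
    splitsAt y = not ⌊ y ≟ᶠ u ⌋ ∧ not ⌊ y ≟ᶠ v ⌋ ∧ (adj K u y xor adj K v y)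
    splitVertex : ∀ y → split (pair u) (pair v) (pair y) ≡ splitsAt y
    splitVertex y rewrite pair-≟ y u | pair-≟ y v | adj≡disjoint u y | adj≡disjoint v y = refl

  maxRedDeg-merged-lower : ∀ {P u v} → u ≢ v → (∀ x y → P x y ≡ pairPartition K u v x y) →
                           2 * (n ∸ 3) ≤ maxRedDeg K P
  maxRedDeg-merged-lower {u = u} u≢v P≗ =
    subst (2 * (n ∸ 3) ≤_) (sym (maxRedDeg-cong K P≗)) (≤-trans (redDeg-merged-lower u≢v) (redDeg≤maxRedDeg K _ u))

  private
    1<N : 1 < N K
    1<N = two≤order (≤-trans (s≤s (s≤s (s≤s z≤n))) 5≤n)
    0<N : 0 < N K
    0<N = <-trans z<s 1<N

  width-lower : (S : ContractionSeq K) → 2 * (n ∸ 3) ≤ width K S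
  width-lower S =
    let u , v , u≢v , first = firstMerge K S {fromℕ< 0<N} {fromℕ< 1<N} (toℕ-fromℕ< 0<N) (toℕ-fromℕ< 1<N)
    in ≤-trans (maxRedDeg-merged-lower u≢v first) (maxRedDeg≤width K S _)

-- The contraction stages

absorbs : ℕ → ℕ → Pair → Bool
absorbs k m (a , b) = (a <ᵇ k) ∨ ((a ≡ᵇ k) ∧ (b ≤ᵇ k + m))

-- The label of a pair is the colex-least member of its part at stage (k , m).
label : ℕ → ℕ → Pair → Pair
label k m (a , b) = if b ≤ᵇ k then (0 , 1) else (if absorbs k m (a , b) then (0 , b) else (a , b))

Absorbed Untouched : ℕ → ℕ → ℕ → ℕ → Set
Absorbed k m a b = (a < k) ⊎ ((a ≡ k) × (b ≤ k + m))
Untouched k m a b = (k < a) ⊎ ((a ≡ k) × (k + m < b))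

absorbs-true⁻ : ∀ {k m a b} → absorbs k m (a , b) ≡ true → Absorbed k m a b
absorbs-true⁻ {k} {m} {a} {b} e with ∨-true⁻ {a <ᵇ k} e
... | inj₁ a<k = inj₁ (<ᵇ-true⁻ a<k)
... | inj₂ a≡k∧b≤ = let a≡k , b≤ = ∧-true⁻ {a ≡ᵇ k} a≡k∧b≤ in
                   inj₂ (≡ᵇ-true⁻ {a} a≡k , ≤ᵇ-true⁻ b≤)

absorbs-false⁻ : ∀ {k m a b} → absorbs k m (a , b) ≡ false → Untouched k m a b
absorbs-false⁻ {k} {m} {a} {b} e with <-cmp k a
... | tri< k<a _ _ = inj₁ k<a
... | tri> _ _ a<k rewrite dec-true (a <? k) a<k = ⊥-elim (true≢false e)
... | tri≈ _ refl _ rewrite dec-false (k <? k) (<-irrefl refl) | dec-true (k ≟ k) refl with b ≤ᵇ k + m in b≤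
...   | false = inj₂ (refl , ≤ᵇ-false⁻ b≤)

absorbed⇒¬untouched : ∀ {k m a b} → Absorbed k m a b → ¬ Untouched k m a b
absorbed⇒¬untouched (inj₁ a<k) (inj₁ k<a) = <-asym a<k k<a
absorbed⇒¬untouched (inj₁ a<k) (inj₂ (refl , _)) = <-irrefl refl a<k
absorbed⇒¬untouched (inj₂ (refl , _)) (inj₁ k<a) = <-irrefl refl k<a
absorbed⇒¬untouched (inj₂ (_ , b≤)) (inj₂ (_ , <b)) = <-irrefl refl (<-≤-trans <b b≤)

data LabelView (k m a b : ℕ) : Set where
  inner     : b ≤ k → label k m (a , b) ≡ (0 , 1) → LabelView k m a b
  absorbed  : k < b → Absorbed k m a b → label k m (a , b) ≡ (0 , b) → LabelView k m a b
  untouched : k < b → Untouched k m a b → label k m (a , b) ≡ (a , b) → LabelView k m a b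

labelView : ∀ k m a b → LabelView k m a b
labelView k m a b with b ≤ᵇ k in b≤k
... | true = inner (≤ᵇ-true⁻ b≤k)
                   (cong (λ t → if t then (0 , 1) else (if absorbs k m (a , b) then (0 , b) else (a , b))) b≤k)
... | false with absorbs k m (a , b) in abs
...   | true = absorbed (≤ᵇ-false⁻ b≤k) (absorbs-true⁻ abs)
                 (cong₂ (λ t t′ → if t then (0 , 1) else (if t′ then (0 , b) else (a , b))) b≤k abs)
...   | false = untouched (≤ᵇ-false⁻ b≤k) (absorbs-false⁻ abs)
                  (cong₂ (λ t t′ → if t then (0 , 1) else (if t′ then (0 , b) else (a , b))) b≤k abs)

label-inner : ∀ k m a {b} → b ≤ k → label k m (a , b) ≡ (0 , 1)
label-inner k m a {b} b≤k with labelView k m a b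
... | inner _ e = e
... | absorbed k<b _ _ = ⊥-elim (<-irrefl refl (<-≤-trans k<b b≤k))
... | untouched k<b _ _ = ⊥-elim (<-irrefl refl (<-≤-trans k<b b≤k))

label-absorbed : ∀ {k m a b} → k < b → Absorbed k m a b → label k m (a , b) ≡ (0 , b)
label-absorbed {k} {m} {a} {b} k<b abs with labelView k m a b
... | inner b≤k _ = ⊥-elim (<-irrefl refl (<-≤-trans k<b b≤k))
... | absorbed _ _ e = e
... | untouched _ unt _ = ⊥-elim (absorbed⇒¬untouched abs unt)

label-untouched : ∀ {k m a b} → k < b → Untouched k m a b → label k m (a , b) ≡ (a , b)
label-untouched {k} {m} {a} {b} k<b unt with labelView k m a b
... | inner b≤k _ = ⊥-elim (<-irrefl refl (<-≤-trans k<b b≤k))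
... | absorbed _ abs _ = ⊥-elim (absorbed⇒¬untouched abs unt)
... | untouched _ _ e = e

absorbed⇒≤ : ∀ {k m a b} → Absorbed k m a b → a ≤ k
absorbed⇒≤ (inj₁ a<k) = <⇒≤ a<k
absorbed⇒≤ (inj₂ (refl , _)) = ≤-refl

untouched⇒positive : ∀ {k m a b} → 1 ≤ k → Untouched k m a b → a ≢ 0
untouched⇒positive 1≤k (inj₁ k<a) refl = <-irrefl refl (≤-<-trans z≤n k<a)
untouched⇒positive 1≤k (inj₂ (refl , _)) refl = <-irrefl refl 1≤k

label-valid : ∀ {n} k m → 1 ≤ k → ∀ {q} → Valid n q → Valid n (label k m q)
label-valid k m 1≤k {a , b} (a<b , b<n) with labelView k m a b
... | inner _ e rewrite e = ≤-refl , ≤-<-trans (≤-trans (s≤s z≤n) a<b) b<n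
... | absorbed _ _ e rewrite e = ≤-<-trans z≤n a<b , b<n
... | untouched _ _ e rewrite e = a<b , b<n

label-idem : ∀ k m → 1 ≤ k → ∀ q → label k m (label k m q) ≡ label k m q
label-idem k m 1≤k (a , b) with labelView k m a b
... | inner _ e rewrite e = label-inner k m 0 1≤k
... | absorbed k<b _ e rewrite e = label-absorbed k<b (inj₁ 1≤k)
... | untouched _ _ e rewrite e = e

label-colex : ∀ k m {a b} → a < b → (label k m (a , b) ≡ (a , b)) ⊎ Colex (label k m (a , b)) (a , b)
label-colex k m {a} {b} a<b with labelView k m a b
label-colex k m {zero} {suc zero} a<b | inner _ e = inj₁ e
label-colex k m {suc a} {suc zero} (s<s ()) | inner _ _
label-colex k m {a} {suc (suc b)} a<b | inner _ e rewrite e = inj₂ (inj₁ (s<s z<s))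
label-colex k m {zero} a<b | absorbed _ _ e = inj₁ e
label-colex k m {suc a} a<b | absorbed _ _ e rewrite e = inj₂ (inj₂ (refl , z<s))
label-colex k m a<b | untouched _ _ e = inj₁ e

01≢0j : ∀ {j} → 1 < j → (0 , 1) ≢ (0 , j)
01≢0j 1<j eq = <-irrefl (cong proj₂ eq) 1<j

0j≢untouched : ∀ {k m c d j} → 1 ≤ k → Untouched k m c d → (0 , j) ≢ (c , d)
0j≢untouched 1≤k unt eq = untouched⇒positive 1≤k unt (sym (cong proj₁ eq))

data SameLabel (k m a b a′ b′ : ℕ) : Set where
  bothInner    : b ≤ k → b′ ≤ k → SameLabel k m a b a′ b′
  bothAbsorbed : b ≡ b′ → k < b → Absorbed k m a b → Absorbed k m a′ b′ → SameLabel k m a b a′ b′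
  identical    : (a , b) ≡ (a′ , b′) → SameLabel k m a b a′ b′

sameLabel : ∀ k m → 1 ≤ k → ∀ {a b a′ b′} → label k m (a , b) ≡ label k m (a′ , b′) →
            SameLabel k m a b a′ b′
sameLabel k m 1≤k {a} {b} {a′} {b′} e with labelView k m a b | labelView k m a′ b′
... | inner b≤k _ | inner b′≤k _ = bothInner b≤k b′≤k
... | absorbed k<b abs e₁ | absorbed _ abs′ e₂ = bothAbsorbed (cong proj₂ (trans (sym e₁) (trans e e₂))) k<b abs abs′
... | untouched _ _ e₁ | untouched _ _ e₂ = identical (trans (sym e₁) (trans e e₂))
... | inner _ e₁ | absorbed k<b′ _ e₂ = ⊥-elim (01≢0j (≤-<-trans 1≤k k<b′) (trans (sym e₁) (trans e e₂)))
... | absorbed k<b _ e₁ | inner _ e₂ = ⊥-elim (01≢0j (≤-<-trans 1≤k k<b) (trans (sym e₂) (trans (sym e) e₁)))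
... | inner _ e₁ | untouched _ unt e₂ = ⊥-elim (0j≢untouched 1≤k unt (trans (sym e₁) (trans e e₂)))
... | absorbed _ _ e₁ | untouched _ unt e₂ = ⊥-elim (0j≢untouched 1≤k unt (trans (sym e₁) (trans e e₂)))
... | untouched _ unt e₁ | inner _ e₂ = ⊥-elim (0j≢untouched 1≤k unt (trans (sym e₂) (trans (sym e) e₁)))
... | untouched _ unt e₁ | absorbed _ _ e₂ = ⊥-elim (0j≢untouched 1≤k unt (trans (sym e₂) (trans (sym e) e₁)))

-- A part labelled by an isolated pair is a singleton without red edges.
Isolated : ℕ → Pair → Set
Isolated k (a , b) = (k < a) ⊎ ((k ≡ 1) × ((a , b) ≡ (0 , 1)))

isolated? : ∀ k q → Dec (Isolated k q)
isolated? k (a , b) = (k <? a) ⊎-dec ((k ≟ 1) ×-dec ((a , b) ≟ₚ (0 , 1)))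

pair-below-2 : ∀ {a b} → a < b → b ≤ 1 → (a , b) ≡ (0 , 1)
pair-below-2 {zero} {suc zero} _ _ = refl
pair-below-2 {suc a} {suc zero} (s<s ()) _
pair-below-2 {b = suc (suc b)} _ (s≤s ())

isolated-preimage : ∀ {k m ℓ a b} → 1 ≤ k → Isolated k ℓ → a < b → label k m (a , b) ≡ ℓ → (a , b) ≡ ℓ
isolated-preimage {k} {m} {ℓ} {a} {b} 1≤k iso a<b e with labelView k m a b | iso
... | untouched _ _ e′ | _ = trans (sym e′) e
... | inner _ e′ | inj₁ k<ℓ₁ = ⊥-elim (<-irrefl (sym (cong proj₁ (trans (sym e) e′))) (≤-<-trans z≤n k<ℓ₁))
... | absorbed _ _ e′ | inj₁ k<ℓ₁ = ⊥-elim (<-irrefl (sym (cong proj₁ (trans (sym e) e′))) (≤-<-trans z≤n k<ℓ₁))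
... | inner b≤1 _ | inj₂ (refl , refl) = pair-below-2 a<b b≤1
... | absorbed 1<b _ e′ | inj₂ (refl , refl) = ⊥-elim (<-irrefl (sym (cong proj₂ (trans (sym e′) e))) 1<b)

disjoint-below : ∀ {k a b t₁ t₂} → a < b → b ≤ k → k < t₁ → t₁ < t₂ → disjoint (a , b) (t₁ , t₂) ≡ true
disjoint-below {k} {a} {b} {t₁} {t₂} a<b b≤k k<t₁ t₁<t₂ = separated (<-trans a<b b<t₁) b<t₁ t₁<t₂
  where
  b<t₁ = ≤-<-trans b≤k k<t₁
  separated : ∀ {a b t₁ t₂} → a < t₁ → b < t₁ → t₁ < t₂ → disjoint (a , b) (t₁ , t₂) ≡ true
  separated {a} {b} {t₁} {t₂} a<t₁ b<t₁ t₁<t₂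
    rewrite dec-false (a ≟ t₁) (<⇒≢ a<t₁) | dec-false (a ≟ t₂) (<⇒≢ (<-trans a<t₁ t₁<t₂))
          | dec-false (b ≟ t₁) (<⇒≢ b<t₁) | dec-false (b ≟ t₂) (<⇒≢ (<-trans b<t₁ t₁<t₂)) = refl

disjoint-straddle : ∀ {k a} b {t₁ t₂} → a ≤ k → k < t₁ → t₁ < t₂ →
                    disjoint (a , b) (t₁ , t₂) ≡ not ((b ≡ᵇ t₁) ∨ (b ≡ᵇ t₂))
disjoint-straddle {k} {a} b {t₁} {t₂} a≤k k<t₁ t₁<t₂
  rewrite dec-false (a ≟ t₁) (<⇒≢ (≤-<-trans a≤k k<t₁))
        | dec-false (a ≟ t₂) (<⇒≢ (<-trans (≤-<-trans a≤k k<t₁) t₁<t₂)) = refl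

disjoint-01 : ∀ {a} b → a ≤ 1 → disjoint (a , b) (0 , 1) ≡ false
disjoint-01 b z≤n = refl
disjoint-01 b (s≤s z≤n) = refl

isolated-uniform : ∀ {k m t u u′} → 1 ≤ k → Isolated k t → proj₁ t < proj₂ t →
                   proj₁ u < proj₂ u → proj₁ u′ < proj₂ u′ → label k m u ≡ label k m u′ → disjoint u t ≡ disjoint u′ t
isolated-uniform {k} {m} {t₁ , t₂} {a , b} {a′ , b′} 1≤k iso t₁<t₂ a<b a′<b′ e
  with sameLabel k m 1≤k {a} {b} {a′} {b′} e | iso
... | identical refl | _ = refl
... | bothInner b≤k b′≤k | inj₁ k<t₁ =
  trans (disjoint-below a<b b≤k k<t₁ t₁<t₂) (sym (disjoint-below a′<b′ b′≤k k<t₁ t₁<t₂))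
... | bothAbsorbed refl _ abs abs′ | inj₁ k<t₁ =
  trans (disjoint-straddle b (absorbed⇒≤ abs) k<t₁ t₁<t₂) (sym (disjoint-straddle b (absorbed⇒≤ abs′) k<t₁ t₁<t₂))
... | bothInner b≤1 b′≤1 | inj₂ (refl , refl) =
  trans (disjoint-01 b (≤-trans (<⇒≤ a<b) b≤1)) (sym (disjoint-01 b′ (≤-trans (<⇒≤ a′<b′) b′≤1)))
... | bothAbsorbed refl _ abs abs′ | inj₂ (refl , refl) =
  trans (disjoint-01 b (absorbed⇒≤ abs)) (sym (disjoint-01 b (absorbed⇒≤ abs′)))

candidate : ℕ → ℕ → Pair → Bool
candidate k m (i , j) = ((i ≡ᵇ 0) ∧ (((j ≡ᵇ 1) ∧ (1 <ᵇ k)) ∨ (k <ᵇ j))) ∨ ((i ≡ᵇ k) ∧ (k + m <ᵇ j))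

fixed-candidate : ∀ {k m a b} → 1 ≤ k → label k m (a , b) ≡ (a , b) → ¬ Isolated k (a , b) →
                  candidate k m (a , b) ≡ true
fixed-candidate {k} {m} {a} {b} 1≤k fixed ¬iso with labelView k m a b
... | inner _ e with trans (sym fixed) e
...   | refl = ∨-true⁺ˡ _ (∨-true⁺ˡ _ (dec-true (1 <? k) (≤∧≢⇒< 1≤k λ 1≡k → ¬iso (inj₂ (sym 1≡k , refl)))))
fixed-candidate {k} {m} {a} {b} 1≤k fixed ¬iso | absorbed k<b _ e with trans (sym fixed) e
...   | refl = ∨-true⁺ˡ _ (∨-true⁺ʳ ((b ≡ᵇ 1) ∧ (1 <ᵇ k)) (dec-true (k <? b) k<b))
fixed-candidate 1≤k fixed ¬iso | untouched _ (inj₁ k<a) _ = ⊥-elim (¬iso (inj₁ k<a))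
fixed-candidate {k} {m} {a} {b} 1≤k fixed ¬iso | untouched _ (inj₂ (refl , k+m<b)) _ =
  ∨-true⁺ʳ _ (∧-true⁺ (dec-true (a ≟ a) refl) (dec-true (a + m <? b) k+m<b))

candidate-rows : ∀ k m i j → candidate k m (i , j) ≡ true → (i ≡ 0) ⊎ (i ≡ k)
candidate-rows k m i j e with ∨-true⁻ {(i ≡ᵇ 0) ∧ (((j ≡ᵇ 1) ∧ (1 <ᵇ k)) ∨ (k <ᵇ j))} e
... | inj₁ row₀ = inj₁ (≡ᵇ-true⁻ {i} (proj₁ (∧-true⁻ {i ≡ᵇ 0} row₀)))
... | inj₂ rowₖ = inj₂ (≡ᵇ-true⁻ {i} (proj₁ (∧-true⁻ {i ≡ᵇ k} rowₖ)))

candidate-count : ∀ n k m → 1 ≤ k →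
                  pairCount n (candidate k m) ≤ indicator (1 <ᵇ k) + (n ∸ suc k) + (n ∸ suc (k + m))
candidate-count n (suc k) m _ = begin
  pairCount n (candidate (suc k) m)
    ≤⟨ pairCount-rows n (suc k) _ (λ i j _ _ → candidate-rows (suc k) m i j) ⟩
  countBelow n (λ j → candidate (suc k) m (0 , j)) + countBelow n (λ j → candidate (suc k) m (suc k , j))
    ≤⟨ +-mono-≤ row₀ rowₖ ⟩
  indicator (1 <ᵇ suc k) + (n ∸ suc (suc k)) + (n ∸ suc (suc k + m)) ∎
  where
  open ≤-Reasoning
  row₀ : countBelow n (λ j → candidate (suc k) m (0 , j)) ≤ indicator (1 <ᵇ suc k) + (n ∸ suc (suc k))
  row₀ = begin
    countBelow n (λ j → candidate (suc k) m (0 , j))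
      ≡⟨ countBelow-cong n (λ j _ → ∨-identityʳ _) ⟩
    countBelow n (λ j → ((j ≡ᵇ 1) ∧ (1 <ᵇ suc k)) ∨ (suc k <ᵇ j))
      ≤⟨ countBelow-∨ n _ _ ⟩
    countBelow n (λ j → (j ≡ᵇ 1) ∧ (1 <ᵇ suc k)) + countBelow n (suc k <ᵇ_)
      ≤⟨ +-mono-≤ (countBelow-≡ᵇ-∧ n 1 _) (≤-reflexive (countBelow-<ᵇ n (suc k))) ⟩
    indicator (1 <ᵇ suc k) + (n ∸ suc (suc k)) ∎
  rowₖ : countBelow n (λ j → candidate (suc k) m (suc k , j)) ≤ n ∸ suc (suc k + m)
  rowₖ = ≤-trans (countBelow-mono n (λ j _ e → proj₂ (∧-true⁻ {k ≡ᵇ k} e)))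
                 (≤-reflexive (countBelow-<ᵇ n (suc k + m)))

n∸2≤1+n∸3 : ∀ n → n ∸ 2 ≤ suc (n ∸ 3)
n∸2≤1+n∸3 n = ≤-trans (m≤n+m∸n (n ∸ 2) 1) (≤-reflexive (cong suc (∸-+-assoc n 2 1)))

candidate-arith : ∀ n k m → 1 ≤ k → ¬ ((k ≡ 1) × (m ≡ 0)) →
                  indicator (1 <ᵇ k) + (n ∸ suc k) + (n ∸ suc (k + m)) ≤ suc (2 * (n ∸ 3))
candidate-arith n (suc zero) zero _ not10 = ⊥-elim (not10 (refl , refl))
candidate-arith n (suc zero) (suc m) _ _ = begin
  (n ∸ 2) + (n ∸ (3 + m)) ≤⟨ +-mono-≤ (n∸2≤1+n∸3 n) (∸-monoʳ-≤ n (m≤m+n 3 m)) ⟩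
  suc (n ∸ 3) + (n ∸ 3)   ≡⟨ cong (λ x → suc (n ∸ 3 + x)) (+-identityʳ (n ∸ 3)) ⟨
  suc (2 * (n ∸ 3))       ∎
  where open ≤-Reasoning
candidate-arith n (suc (suc k)) m _ _ = s≤s (begin
  (n ∸ (3 + k)) + (n ∸ (3 + (k + m))) ≤⟨ +-mono-≤ (∸-monoʳ-≤ n (m≤m+n 3 k)) (∸-monoʳ-≤ n (m≤m+n 3 (k + m))) ⟩
  (n ∸ 3) + (n ∸ 3)                   ≡⟨ cong (n ∸ 3 +_) (+-identityʳ (n ∸ 3)) ⟨
  2 * (n ∸ 3)                         ∎)
  where open ≤-Reasoning

label-start : ∀ {a b} → a < b → label 1 0 (a , b) ≡ (a , b)
label-start {a} {b} a<b with labelView 1 0 a b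
... | inner b≤1 e = trans e (sym (pair-below-2 a<b b≤1))
label-start a<b | absorbed _ (inj₁ z<s) e = e
label-start a<b | absorbed 1<b (inj₂ (_ , b≤1)) _ = ⊥-elim (<-irrefl refl (<-≤-trans 1<b b≤1))
label-start a<b | untouched _ _ e = e

absorbed-suc : ∀ {k m a c} → Absorbed k m a c → Absorbed k (suc m) a c
absorbed-suc (inj₁ a<k) = inj₁ a<k
absorbed-suc {k} {m} (inj₂ (a≡k , c≤)) = inj₂ (a≡k , ≤-trans c≤ (+-monoʳ-≤ k (n≤1+n m)))

label-step-m : ∀ {k m a c} → 1 ≤ k → a < c →
               label k (suc m) (a , c) ≡ redirect _≟ₚ_ (0 , suc (k + m)) (k , suc (k + m)) (label k m (a , c))
label-step-m {k} {m} {a} {c} 1≤k a<c with labelView k m a c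
... | inner c≤k e rewrite e | label-inner k (suc m) a c≤k =
  sym (redirect-other _≟ₚ_ (0 , suc (k + m)) (k , suc (k + m)) λ e′ → <-irrefl (cong proj₁ e′) 1≤k)
... | absorbed k<c abs e rewrite e | label-absorbed {m = suc m} k<c (absorbed-suc abs) =
  sym (redirect-other _≟ₚ_ (0 , suc (k + m)) (k , suc (k + m)) λ e′ → <-irrefl (cong proj₁ e′) 1≤k)
... | untouched k<c (inj₁ k<a) e rewrite e | label-untouched {m = suc m} k<c (inj₁ k<a) =
  sym (redirect-other _≟ₚ_ (0 , suc (k + m)) (k , suc (k + m)) λ e′ → <-irrefl (sym (cong proj₁ e′)) k<a)
... | untouched k<c (inj₂ (refl , a+m<c)) e rewrite e = [ beyond , reached ]′ (m≤n⇒m<n∨m≡n a+m<c)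
  where
  a+m+1≡ : a + suc m ≡ suc (a + m)
  a+m+1≡ = +-suc a m
  beyond : suc (a + m) < c → label a (suc m) (a , c) ≡ redirect _≟ₚ_ (0 , suc (a + m)) (a , suc (a + m)) (a , c)
  beyond a+m+1<c = trans (label-untouched k<c (inj₂ (refl , subst (_< c) (sym a+m+1≡) a+m+1<c)))
    (sym (redirect-other _≟ₚ_ (0 , suc (a + m)) (a , suc (a + m)) λ e′ → <-irrefl (sym (cong proj₂ e′)) a+m+1<c))
  reached : suc (a + m) ≡ c → label a (suc m) (a , c) ≡ redirect _≟ₚ_ (0 , suc (a + m)) (a , suc (a + m)) (a , c)
  reached refl = trans (label-absorbed k<c (inj₂ (refl , ≤-reflexive (sym a+m+1≡)))) (sym (redirect-target _≟ₚ_))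

label-step-k : ∀ {n k m a c} → 1 ≤ k → ¬ suc (k + m) < n → a < c → c < n →
               label (suc k) 0 (a , c) ≡ redirect _≟ₚ_ (0 , 1) (0 , suc k) (label k m (a , c))
label-step-k {n} {k} {m} {a} {c} 1≤k last a<c c<n with labelView k m a c
... | inner c≤k e rewrite e | label-inner (suc k) 0 a (≤-trans c≤k (n≤1+n k)) =
  sym (redirect-other _≟ₚ_ (0 , 1) (0 , suc k) λ e′ → <-irrefl (cong proj₂ e′) (s≤s 1≤k))
... | absorbed k<c abs e rewrite e = [ beyond , reached ]′ (m≤n⇒m<n∨m≡n k<c)
  where
  beyond : suc k < c → label (suc k) 0 (a , c) ≡ redirect _≟ₚ_ (0 , 1) (0 , suc k) (0 , c)
  beyond k+1<c = trans (label-absorbed k+1<c (inj₁ (s≤s (absorbed⇒≤ abs))))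
    (sym (redirect-other _≟ₚ_ (0 , 1) (0 , suc k) λ e′ → <-irrefl (sym (cong proj₂ e′)) k+1<c))
  reached : suc k ≡ c → label (suc k) 0 (a , c) ≡ redirect _≟ₚ_ (0 , 1) (0 , suc k) (0 , c)
  reached refl = trans (label-inner (suc k) 0 a ≤-refl) (sym (redirect-target _≟ₚ_))
label-step-k {n} {k} {m} {a} {c} 1≤k last a<c c<n | untouched _ (inj₂ (_ , k+m<c)) _ = ⊥-elim (last (≤-<-trans k+m<c c<n))
label-step-k {n} {k} {m} {a} {c} 1≤k last a<c c<n | untouched _ (inj₁ k<a) e rewrite e =
  trans (label-untouched (≤-<-trans k<a a<c) (above (m≤n⇒m<n∨m≡n k<a)))
        (sym (redirect-other _≟ₚ_ (0 , 1) (0 , suc k) λ e′ → <-irrefl (sym (cong proj₁ e′)) (≤-<-trans z≤n k<a)))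
  where
  above : (suc k < a) ⊎ (suc k ≡ a) → Untouched (suc k) 0 a c
  above (inj₁ k+1<a) = inj₁ k+1<a
  above (inj₂ refl) = inj₂ (refl , subst (_< c) (sym (+-identityʳ (suc k))) a<c)

module Stages (n : ℕ) where
  open Kneser n

  stagePartition : ℕ → ℕ → Partition (N K)
  stagePartition k m = kernel _≟ₚ_ (label k m ∘ pair)

  module _ {k m : ℕ} (1≤k : 1 ≤ k) where
    private
      P = stagePartition k m
      labelOf : Vertex → Pair
      labelOf = label k m ∘ pair
      sameLabel⁻ : ∀ {x y} → P x y ≡ true → labelOf x ≡ labelOf y
      sameLabel⁻ {x} {y} = ⌊⌋-true⁻ (labelOf x ≟ₚ labelOf y)

    representative-fixed : ∀ y → isRep K P y ≡ true → labelOf y ≡ pair y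
    representative-fixed y rep = [ id , ⊥-elim ∘ notSmaller ]′ (label-colex k m (proj₁ (pair-valid y)))
      where
      found = pair-surjective (label-valid k m 1≤k (pair-valid y))
      z = proj₁ found
      z∈y : P z y ≡ true
      z∈y = ⌊⌋-true (labelOf z ≟ₚ labelOf y) (trans (cong (label k m) (proj₂ found)) (label-idem k m 1≤k (pair y)))
      z<y : Colex (labelOf y) (pair y) → ⌊ z <ᶠ? y ⌋ ≡ true
      z<y smaller = ⌊⌋-true (z <ᶠ? y) (pair-colex⁻ (subst (λ q → Colex q (pair y)) (sym (proj₂ found)) smaller))
      notSmaller : ¬ Colex (labelOf y) (pair y)
      notSmaller smaller = true≢false (trans (sym z∈y) (isRep-minimal K {P} z rep (z<y smaller)))

    isolated-noRedEdge : ∀ x y → Isolated k (labelOf x) ⊎ Isolated k (labelOf y) → redEdge K P x y ≢ true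
    isolated-noRedEdge x y iso red = true≢false (begin
      true                          ≡⟨ edge ⟨
      adj K u w                     ≡⟨ adj≡disjoint u w ⟩
      disjoint (pair u) (pair w)    ≡⟨ uniform iso ⟩
      disjoint (pair u′) (pair w′)  ≡⟨ adj≡disjoint u′ w′ ⟨
      adj K u′ w′                   ≡⟨ nonEdge ⟩
      false                         ∎)
      where
      open ≡-Reasoning
      open RedEdgeWitness (redEdge-witness K P x y red)
      ordered : ∀ v → proj₁ (pair v) < proj₂ (pair v)
      ordered v = proj₁ (pair-valid v)
      sameLabel′ : ∀ {z t t′} → P z t ≡ true → P z t′ ≡ true → labelOf t ≡ labelOf t′
      sameLabel′ z∋t z∋t′ = trans (sym (sameLabel⁻ z∋t)) (sameLabel⁻ z∋t′)
      singleton : ∀ {z t t′} → Isolated k (labelOf z) → P z t ≡ true → P z t′ ≡ true → pair t ≡ pair t′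
      singleton iso z∋t z∋t′ = trans (isolated-preimage 1≤k iso (ordered _) (sym (sameLabel⁻ z∋t)))
                                 (sym (isolated-preimage 1≤k iso (ordered _) (sym (sameLabel⁻ z∋t′))))
      isolatedPair : ∀ {z t} → Isolated k (labelOf z) → P z t ≡ true → Isolated k (pair t)
      isolatedPair iso z∋t = subst (Isolated k) (sym (isolated-preimage 1≤k iso (ordered _) (sym (sameLabel⁻ z∋t)))) iso
      uniform : Isolated k (labelOf x) ⊎ Isolated k (labelOf y) →
                disjoint (pair u) (pair w) ≡ disjoint (pair u′) (pair w′)
      uniform (inj₁ isoˣ) = begin
        disjoint (pair u) (pair w)    ≡⟨ cong (λ q → disjoint q (pair w)) (singleton isoˣ u∈x u′∈x) ⟩
        disjoint (pair u′) (pair w)   ≡⟨ disjoint-sym (pair u′) (pair w) ⟩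
        disjoint (pair w) (pair u′)   ≡⟨ isolated-uniform 1≤k (isolatedPair isoˣ u′∈x) (ordered u′)
                                           (ordered w) (ordered w′) (sameLabel′ w∈y w′∈y) ⟩
        disjoint (pair w′) (pair u′)  ≡⟨ disjoint-sym (pair w′) (pair u′) ⟩
        disjoint (pair u′) (pair w′)  ∎
      uniform (inj₂ isoʸ) = begin
        disjoint (pair u) (pair w)    ≡⟨ isolated-uniform 1≤k (isolatedPair isoʸ w∈y) (ordered w)
                                           (ordered u) (ordered u′) (sameLabel′ u∈x u′∈x) ⟩
        disjoint (pair u′) (pair w)   ≡⟨ cong (disjoint (pair u′)) (singleton isoʸ w∈y w′∈y) ⟩
        disjoint (pair u′) (pair w′)  ∎

    -- The label of x is a candidate but not a red neighbour.
    active-redDeg : ¬ ((k ≡ 1) × (m ≡ 0)) → ∀ x → ¬ Isolated k (labelOf x) → redDeg K P x ≤ 2 * (n ∸ 3)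
    active-redDeg not10 x ¬iso = ≤-pred (begin
      suc (redDeg K P x)                                    ≤⟨ s≤s (count-mono K {redNeighbour} neighbour) ⟩
      suc (count K (λ y → candidate k m (pair y) ∧ not ⌊ y ≟ᶠ z ⌋))
                                                            ≡⟨ count-remove K (candidate k m ∘ pair) z-candidate ⟨
      count K (candidate k m ∘ pair)                        ≡⟨ count≡pairCount (candidate k m) ⟩
      pairCount n (candidate k m)                           ≤⟨ candidate-count n k m 1≤k ⟩
      indicator (1 <ᵇ k) + (n ∸ suc k) + (n ∸ suc (k + m))  ≤⟨ candidate-arith n k m 1≤k not10 ⟩
      suc (2 * (n ∸ 3))                                     ∎)
      where
      open ≤-Reasoning
      redNeighbour : Vertex → Bool
      redNeighbour y = isRep K P y ∧ redEdge K P x y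
      found = pair-surjective (label-valid k m 1≤k (pair-valid x))
      z = proj₁ found
      z-candidate : candidate k m (pair z) ≡ true
      z-candidate = subst (λ q → candidate k m q ≡ true) (sym (proj₂ found))
                      (fixed-candidate 1≤k (label-idem k m 1≤k (pair x)) ¬iso)
      neighbour : ∀ y → redNeighbour y ≡ true → candidate k m (pair y) ∧ not ⌊ y ≟ᶠ z ⌋ ≡ true
      neighbour y e = ∧-true⁺ (fixed-candidate 1≤k fixed ¬isoʸ) (not-true⁺ (⌊⌋-false (y ≟ᶠ z) y≢z))
        where
        rep = proj₁ (∧-true⁻ {isRep K P y} e)
        red = proj₂ (∧-true⁻ {isRep K P y} e)
        fixed = representative-fixed y rep
        ¬isoʸ : ¬ Isolated k (pair y)
        ¬isoʸ iso = isolated-noRedEdge x y (inj₂ (subst (Isolated k) (sym fixed) iso)) red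
        separate : P x y ≡ false
        separate = not-true⁻ (proj₁ (∧-true⁻ {not (P x y)} red))
        y≢z : y ≢ z
        y≢z y≡z = true≢false (trans (sym (⌊⌋-true (labelOf x ≟ₚ labelOf y) sameLabels)) separate)
          where
          sameLabels : labelOf x ≡ labelOf y
          sameLabels = trans (sym (proj₂ found)) (trans (cong pair (sym y≡z)) (sym fixed))

  stagePartition-start : ∀ x y → stagePartition 1 0 x y ≡ discrete (N K) x y
  stagePartition-start x y =
    trans (cong₂ (λ a b → ⌊ a ≟ₚ b ⌋) (label-start (proj₁ (pair-valid x))) (label-start (proj₁ (pair-valid y))))
          (pair-≟ x y)

  start-singletons : ∀ x y → stagePartition 1 0 x y ≡ true → x ≡ y
  start-singletons x y e = ⌊⌋-true⁻ (x ≟ᶠ y) (trans (sym (stagePartition-start x y)) e)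

  stage-redDeg : ∀ k m → 1 ≤ k → ∀ x → redDeg K (stagePartition k m) x ≤ 2 * (n ∸ 3)
  stage-redDeg k m 1≤k x = cases ((k ≟ 1) ×-dec (m ≟ 0)) (isolated? k (label k m (pair x)))
    where
    noRed : (∀ y → redEdge K (stagePartition k m) x y ≢ true) → redDeg K (stagePartition k m) x ≤ 2 * (n ∸ 3)
    noRed none = ≤-trans (≤-reflexive (redDeg-none K (stagePartition k m) x none)) z≤n
    cases : Dec ((k ≡ 1) × (m ≡ 0)) → Dec (Isolated k (label k m (pair x))) →
            redDeg K (stagePartition k m) x ≤ 2 * (n ∸ 3)
    cases (yes (k≡1 , m≡0)) _ = noRed λ y → redEdge-singletons K {stagePartition k m}
      (λ x′ y′ → start-singletons x′ y′ ∘ subst₂ (λ k m → stagePartition k m x′ y′ ≡ true) k≡1 m≡0) x y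
    cases (no _) (yes iso) = noRed λ y → isolated-noRedEdge 1≤k x y (inj₁ iso)
    cases (no not10) (no ¬iso) = active-redDeg 1≤k not10 x ¬iso

-- The contraction sequence

module Construction (n : ℕ) where
  open Kneser n
  open Stages n

  order≡sumBelow : N K ≡ sumBelow n id
  order≡sumBelow = begin
    N K                                ≡⟨ length-tabulate id ⟨
    length (allFin (N K))              ≡⟨ everything (allFin (N K)) ⟨
    countList (λ _ → true) (allFin (N K)) ≡⟨ length-filter-true (λ _ → true) (allFin (N K)) ⟨
    count K (λ _ → true)               ≡⟨ count≡pairCount (λ _ → true) ⟩
    pairCount n (λ _ → true)           ≡⟨ sumBelow-cong n column ⟩
    sumBelow n id                      ∎
    where
    open ≡-Reasoning
    column : ∀ j → j < n → countBelow n (λ i → (i <ᵇ j) ∧ true) ≡ j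
    column j j<n = trans (countBelow-cong n (λ i _ → ∧-identityʳ (i <ᵇ j))) (countBelow-below n j (<⇒≤ j<n))
    everything : ∀ {A : Set} (xs : List A) → countList (λ _ → true) xs ≡ length xs
    everything [] = refl
    everything (_ ∷ xs) = cong suc (everything xs)

  nextRow : ℕ → ℕ → Pair
  nextRow k m = if suc k <ᵇ n then (suc k , 0) else (k , m)

  next : Pair → Pair
  next (k , m) = if suc (k + m) <ᵇ n then (k , suc m) else nextRow k m

  next-by : ∀ {k m b} → (suc (k + m) <ᵇ n) ≡ b → next (k , m) ≡ (if b then (k , suc m) else nextRow k m)
  next-by {k} {m} = cong (λ b → if b then (k , suc m) else nextRow k m)

  nextRow-by : ∀ {k m b} → (suc k <ᵇ n) ≡ b → nextRow k m ≡ (if b then (suc k , 0) else (k , m))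
  nextRow-by {k} {m} = cong (λ b → if b then (suc k , 0) else (k , m))

  data NextView (k m : ℕ) : Set where
    advance-m : suc (k + m) < n → next (k , m) ≡ (k , suc m) → NextView k m
    advance-k : ¬ suc (k + m) < n → suc k < n → next (k , m) ≡ (suc k , 0) → NextView k m
    finished  : ¬ suc (k + m) < n → ¬ suc k < n → next (k , m) ≡ (k , m) → NextView k m

  nextView : ∀ k m → NextView k m
  nextView k m with suc (k + m) <ᵇ n in m-step
  ... | true = advance-m (<ᵇ-true⁻ m-step) (next-by m-step)
  ... | false with suc k <ᵇ n in k-step
  ...   | true = advance-k (<ᵇ-false⁻ m-step) (<ᵇ-true⁻ k-step) (trans (next-by m-step) (nextRow-by k-step))
  ...   | false = finished (<ᵇ-false⁻ m-step) (<ᵇ-false⁻ k-step) (trans (next-by m-step) (nextRow-by k-step))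

  Admissible : Pair → Set
  Admissible (k , m) = (1 ≤ k) × (k + m < n)

  admissible-next : ∀ {k m} → Admissible (k , m) → Admissible (next (k , m))
  admissible-next {k} {m} (1≤k , k+m<n) with nextView k m
  ... | advance-m lt e rewrite e = 1≤k , subst (_< n) (sym (+-suc k m)) lt
  ... | advance-k _ lt e rewrite e = s≤s z≤n , subst (_< n) (sym (+-identityʳ (suc k))) lt
  ... | finished _ _ e rewrite e = 1≤k , k+m<n

  -- The merges left in row k, and then in the rows k + 1, … , n - 2.
  remaining : Pair → ℕ
  remaining (k , m) = (n ∸ suc (k + m)) + triangle (n ∸ suc k)

  finished-remaining : ∀ {k m} → ¬ suc (k + m) < n → ¬ suc k < n → remaining (k , m) ≡ 0
  finished-remaining last last′ rewrite m≤n⇒m∸n≡0 (≮⇒≥ last) | m≤n⇒m∸n≡0 (≮⇒≥ last′) = refl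

  remaining-next : ∀ {k m} → 0 < remaining (k , m) → suc (remaining (next (k , m))) ≡ remaining (k , m)
  remaining-next {k} {m} pos with nextView k m
  ... | advance-m lt e rewrite e = begin
    suc ((n ∸ suc (k + suc m)) + Tₖ)    ≡⟨ cong (λ z → suc ((n ∸ suc z) + Tₖ)) (+-suc k m) ⟩
    suc ((n ∸ suc (suc (k + m))) + Tₖ)  ≡⟨ cong (_+ Tₖ) (+-∸-assoc 1 lt) ⟨
    (n ∸ suc (k + m)) + Tₖ              ∎
    where
    open ≡-Reasoning
    Tₖ = triangle (n ∸ suc k)
  ... | advance-k last lt e rewrite e = begin
    suc ((n ∸ suc (suc k + 0)) + triangle r) ≡⟨ cong (λ z → suc ((n ∸ suc z) + triangle r)) (+-identityʳ (suc k)) ⟩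
    triangle (suc r)                         ≡⟨ cong triangle (+-∸-assoc 1 lt) ⟨
    triangle (n ∸ suc k)                     ≡⟨ cong (_+ triangle (n ∸ suc k)) (m≤n⇒m∸n≡0 (≮⇒≥ last)) ⟨
    (n ∸ suc (k + m)) + triangle (n ∸ suc k) ∎
    where
    open ≡-Reasoning
    r = n ∸ suc (suc k)
  ... | finished last last′ _ = ⊥-elim (<-irrefl (sym (finished-remaining last last′)) pos)

  mergeStep-m : ∀ {k m} → 1 ≤ k → suc (k + m) < n → MergeStep (stagePartition k m) (stagePartition k (suc m))
  mergeStep-m {k} {m} 1≤k lt =
    kernel-mergeStep _≟ₚ_ {u = proj₁ u} {v = proj₁ v} (λ e → <-irrefl (cong proj₁ e) 1≤k)
      (trans (cong (label k m) (proj₂ u)) (label-absorbed k<k+m+1 (inj₁ 1≤k)))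
      (trans (cong (label k m) (proj₂ v)) (label-untouched k<k+m+1 (inj₂ (refl , ≤-refl))))
      (λ x → label-step-m 1≤k (proj₁ (pair-valid x)))
    where
    k<k+m+1 = s≤s (m≤m+n k m)
    u = pair-surjective {0 , suc (k + m)} (z<s , lt)
    v = pair-surjective {k , suc (k + m)} (k<k+m+1 , lt)

  mergeStep-k : ∀ {k m} → 1 ≤ k → ¬ suc (k + m) < n → suc k < n →
                MergeStep (stagePartition k m) (stagePartition (suc k) 0)
  mergeStep-k {k} {m} 1≤k last lt =
    kernel-mergeStep _≟ₚ_ {u = proj₁ u} {v = proj₁ v} (λ e → <-irrefl (cong proj₂ e) (s≤s 1≤k))
      (trans (cong (label k m) (proj₂ u)) (label-inner k m 0 1≤k))
      (trans (cong (label k m) (proj₂ v)) (label-absorbed ≤-refl (inj₁ 1≤k)))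
      (λ x → label-step-k 1≤k last (proj₁ (pair-valid x)) (proj₂ (pair-valid x)))
    where
    u = pair-surjective {0 , 1} (z<s , <-trans (s≤s 1≤k) lt)
    v = pair-surjective {0 , suc k} (z<s , lt)

  mergeStep-next : ∀ {k m} → 1 ≤ k → 0 < remaining (k , m) →
                   MergeStep (stagePartition k m) (uncurry stagePartition (next (k , m)))
  mergeStep-next {k} {m} 1≤k pos = byView (nextView k m)
    where
    byView : NextView k m → MergeStep (stagePartition k m) (uncurry stagePartition (next (k , m)))
    byView (advance-m lt e) = subst (MergeStep (stagePartition k m) ∘ uncurry stagePartition) (sym e)
                                (mergeStep-m 1≤k lt)
    byView (advance-k last lt e) = subst (MergeStep (stagePartition k m) ∘ uncurry stagePartition) (sym e)
                                     (mergeStep-k 1≤k last lt)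
    byView (finished last last′ _) = ⊥-elim (<-irrefl (sym (finished-remaining last last′)) pos)

  stage : ℕ → Pair
  stage zero = (1 , 0)
  stage (suc t) = next (stage t)

  module _ (2≤n : 2 ≤ n) where

    admissible-stage : ∀ t → Admissible (stage t)
    admissible-stage zero = ≤-refl , 2≤n
    admissible-stage (suc t) = admissible-next (admissible-stage t)

    remaining-start : remaining (1 , 0) + 1 ≡ N K
    remaining-start = initially n 2≤n (sym order≡sumBelow)
      where
      initially : ∀ n → 2 ≤ n → sumBelow n id ≡ N K → (n ∸ 2) + triangle (n ∸ 2) + 1 ≡ N K
      initially (suc (suc r)) (s≤s (s≤s z≤n)) e = trans (+-comm _ 1) (trans (sym (sumBelow-id (suc r))) e)

    remaining-stage : ∀ t → t < N K → remaining (stage t) + suc t ≡ N K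
    remaining-stage zero _ = remaining-start
    remaining-stage (suc t) lt = begin
      remaining (next (stage t)) + suc (suc t)   ≡⟨ +-suc _ (suc t) ⟩
      suc (remaining (next (stage t))) + suc t   ≡⟨ cong (_+ suc t) (remaining-next (positive _ previous lt)) ⟩
      remaining (stage t) + suc t                ≡⟨ previous ⟩
      N K                                        ∎
      where
      open ≡-Reasoning
      previous = remaining-stage t (<-trans (n<1+n t) lt)
      positive : ∀ r → r + suc t ≡ N K → suc t < N K → 0 < r
      positive zero e lt = ⊥-elim (<-irrefl e lt)
      positive (suc r) _ _ = z<s

    staged : ContractionSeq K
    staged = record { seq = seq′ ; start = start′ ; merges = merges′ }
      where
      seq′ : Vertex → Partition (N K)
      seq′ t = uncurry stagePartition (stage (toℕ t))
      start′ : ∀ t → toℕ t ≡ 0 → ∀ x y → seq′ t x y ≡ discrete (N K) x y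
      start′ t t≡0 = subst (λ s → ∀ x y → uncurry stagePartition (stage s) x y ≡ discrete (N K) x y) (sym t≡0)
                       stagePartition-start
      merges′ : ∀ t t′ → toℕ t′ ≡ suc (toℕ t) → MergeStep (seq′ t) (seq′ t′)
      merges′ t t′ e = subst (λ s → MergeStep (seq′ t) (uncurry stagePartition (stage s))) (sym e)
        (mergeStep-next (proj₁ (admissible-stage (toℕ t))) (positive (remaining-stage (toℕ t) (toℕ<n t))))
        where
        positive : remaining (stage (toℕ t)) + suc (toℕ t) ≡ N K → 0 < remaining (stage (toℕ t))
        positive eq with remaining (stage (toℕ t))
        ... | zero = ⊥-elim (<-irrefl eq (subst (_< N K) e (toℕ<n t′)))
        ... | suc _ = z<s

    staged-width : width K staged ≤ 2 * (n ∸ 3)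
    staged-width = width-least K staged λ t → maxRedDeg-least K _ λ x →
      stage-redDeg (proj₁ (stage (toℕ t))) (proj₂ (stage (toℕ t))) (proj₁ (admissible-stage (toℕ t))) x

twinWidth-staged : ∀ {n} → 2 ≤ n → (∀ S → 2 * (n ∸ 3) ≤ width (Kneser2 n) S) → TwwIs (Kneser2 n) (2 * (n ∸ 3))
twinWidth-staged {n} 2≤n = twinWidth-attained (Kneser2 n) (staged 2≤n) (staged-width 2≤n)
  where open Construction n

lb₁-large : ∀ {n} → 5 ≤ n → Lb1Is (Kneser2 n) (2 * (n ∸ 3))
lb₁-large {n} 5≤n = lb₁-attained K (two≤order 3≤n) (staged 2≤n) (staged-width 2≤n)
  λ u v u≢v → maxRedDeg-merged-lower 5≤n u≢v (λ _ _ → refl)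
  where
  open Kneser n
  open Construction n
  3≤n = ≤-trans (s≤s (s≤s (s≤s z≤n))) 5≤n
  2≤n = ≤-trans (s≤s (s≤s z≤n)) 5≤n

lb₁-three : Lb1Is (Kneser2 3) 0
lb₁-three = inj₂ (s≤s (s≤s z≤n) , (zero , suc zero , (λ ()) , refl) , λ _ _ _ → z≤n)

-- The vertices are listed as 01, 02, 12, 03, 13, 23: the edges 01–23, 02–13 and 12–03 are
-- contracted first, and then the resulting parts are merged.
matching-classes : Vec (Vec ℕ 6) 6
matching-classes = (0 ∷ 1 ∷ 2 ∷ 3 ∷ 4 ∷ 5 ∷ [])
                 ∷ (0 ∷ 1 ∷ 2 ∷ 3 ∷ 4 ∷ 0 ∷ [])
                 ∷ (0 ∷ 1 ∷ 2 ∷ 3 ∷ 1 ∷ 0 ∷ [])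
                 ∷ (0 ∷ 1 ∷ 2 ∷ 2 ∷ 1 ∷ 0 ∷ [])
                 ∷ (0 ∷ 0 ∷ 2 ∷ 2 ∷ 0 ∷ 0 ∷ [])
                 ∷ (0 ∷ 0 ∷ 0 ∷ 0 ∷ 0 ∷ 0 ∷ []) ∷ []

matching-sequence : ContractionSeq (Kneser2 4)
matching-sequence = checkedSeq (Kneser2 4) (λ t → kernel _≟_ (lookupᵥ (lookupᵥ matching-classes t))) _

twinWidth-four : TwwIs (Kneser2 4) 0
twinWidth-four = twinWidth-attained (Kneser2 4) matching-sequence (≤-reflexive refl) (λ _ → z≤n)

lb₁-four : Lb1Is (Kneser2 4) 0
lb₁-four = inj₂ (s≤s (s≤s z≤n) , (zero , suc (suc (suc (suc (suc zero)))) , (λ ()) , refl) , λ _ _ _ → z≤n)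

corollary4p5 : (n : ℕ) → 2 ≤ n →
    ((5 ≤ n) × TwwIs (Kneser2 n) (2 * (n ∸ 3)) × Lb1Is (Kneser2 n) (2 * (n ∸ 3)))
    ⊎ ((n ≤ 4) × TwwIs (Kneser2 n) 0 × Lb1Is (Kneser2 n) 0)
corollary4p5 1 (s≤s ())
corollary4p5 2 2≤n = inj₂ (s≤s (s≤s z≤n) , twinWidth-staged 2≤n (λ _ → z≤n) , inj₁ (s≤s z≤n , refl))
corollary4p5 3 2≤n = inj₂ (s≤s (s≤s (s≤s z≤n)) , twinWidth-staged 2≤n (λ _ → z≤n) , lb₁-three)
corollary4p5 4 _ = inj₂ (≤-refl , twinWidth-four , lb₁-four)
corollary4p5 n@(suc (suc (suc (suc (suc _))))) 2≤n =
  inj₁ (5≤n , twinWidth-staged 2≤n (width-lower 5≤n) , lb₁-large 5≤n)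
  where
  5≤n : 5 ≤ n
  5≤n = s≤s (s≤s (s≤s (s≤s (s≤s z≤n))))
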